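{- There is an absolute constant $c>0$ such that the following holds for all sufficiently large $d$. Let $1\le\Delta\le\log_2 d$ and let $f\in\mathbb{F}[X]$ be computed by a syntactic multilinear $(\Sigma\Pi)^{\Delta}\Sigma$ formula of size at most $s$. Then there is an integer $t\ge c\,\Delta d^{1/\Delta}$ such that $f$ is the sum of at most $s$ many $t$-product polynomials and at most $s$ many $t$-simple polynomials.
   Context: $\mathbb{F}$ is a field; $X=\bigcup_{i\in[d]}X^{(i)}$ where $X^{(i)}=\{x^{(i)}_{j,k}:j,k\in\{1,2\}\}$ are disjoint sets of variables (so $|X|=4d$). A polynomial $f\in\mathbb{F}[X]$ is a $t$-product polynomial if $f=f_1\cdots f_t$ where there is a partition of $X$ into non-empty sets $X_1,\dots,X_t$ with each $f_i$ a multilinear polynomial in $\mathbb{F}[X_i]$ ($f_i$ need not depend on all of $X_i$). A polynomial $f$ is $r$-simple if $f=L_1\cdots L_{r'}\cdot G$ with $r'\le r$, where this is an $(r'+1)$-product polynomial with respect to a partition $X_1,\dots,X_{r'},X_{r'+1}$, each $L_i$ has degree at most $1$, and $|X_1\cup\dots\cup X_{r'}|\ge 400r$. Formulas have unbounded fan-in; size is the number of gates including inputs; a formula is syntactic multilinear if for every product gate the variable sets of the subformulas of its children are pairwise disjoint; a $(\Sigma\Pi)^{\Delta}\Sigma$ formula has a sum output gate, alternates sum and product gates along every path with exactly $\Delta$ product gates, and has a sum gate at the bottom. -}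

module Defs where

open import Level using (0ℓ)
open import Algebra.Bundles using (CommutativeRing)
open import Data.Nat using (ℕ; zero; suc)
import Data.Nat as N
open import Data.Fin using (Fin; zero; suc; inject₁; fromℕ)
open import Data.Fin.Subset using (Subset; inside; outside; _⊆_; _∩_; _∪_; _─_; ∁; ∣_∣; Empty; ⁅_⁆)
import Data.Fin.Subset as Sub
open import Data.List using (List; []; _∷_; _++_; map; length)
open import Data.Vec using (Vec; []; _∷_; tabulate)
open import Data.Vec.Properties using (≡-dec)
open import Data.Bool using (Bool; if_then_else_)
import Data.Bool.Properties as BoolP
import Data.Fin.Properties as FinP
open import Data.Product using (Σ; ∃; _×_; _,_)
open import Data.Unit using (⊤)
open import Relation.Nullary using (¬_; does)
open import Relation.Binary.PropositionalEquality using (_≡_)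

record Field : Set₁ where
  field
    commRing : CommutativeRing 0ℓ 0ℓ
  open CommutativeRing commRing public
  field
    0≉1 : ¬ (0# ≈ 1#)
    inverse : ∀ x → ¬ (x ≈ 0#) → ∃ λ y → (x * y) ≈ 1#

subsetsOf : ∀ {n} → Subset n → List (Subset n)
subsetsOf [] = [] ∷ []
subsetsOf (outside ∷ S) = map (outside ∷_) (subsetsOf S)
subsetsOf (inside ∷ S) = map (outside ∷_) (subsetsOf S) ++ map (inside ∷_) (subsetsOf S)

block : ∀ {n t} → (Fin n → Fin t) → Fin t → Subset n
block part i = tabulate (λ x → if does (part x FinP.≟ i) then inside else outside)

Surjective : ∀ {n t} → (Fin n → Fin t) → Set
Surjective {t = t} part = (i : Fin t) → ∃ λ x → part x ≡ i

module Poly (F : Field) where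
  open Field F using (Carrier; _≈_; _+_; _*_; 0#; 1#)

  -- Multilinear polynomials in the variables x_0..x_{n-1}: a monomial is
  -- a subset of the variables, and a polynomial is its coefficient map.
  MPoly : ℕ → Set
  MPoly n = Subset n → Carrier

  module _ {n : ℕ} where

    _≐_ : MPoly n → MPoly n → Set
    p ≐ q = ∀ S → p S ≈ q S

    δ : Subset n → Carrier → MPoly n
    δ A c S = if does (≡-dec BoolP._≟_ S A) then c else 0#

    zeroP oneP : MPoly n
    zeroP S = 0#
    oneP = δ Sub.⊥ 1#

    varP : Fin n → MPoly n
    varP i = δ ⁅ i ⁆ 1#

    constP : Carrier → MPoly n
    constP c = δ Sub.⊥ c

    _⊕_ : MPoly n → MPoly n → MPoly n
    (p ⊕ q) S = p S + q S

    sumL : List (MPoly n) → MPoly n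
    sumL [] = zeroP
    sumL (p ∷ ps) = p ⊕ sumL ps

    sumC : List Carrier → Carrier
    sumC [] = 0#
    sumC (c ∷ cs) = c + sumC cs

    -- Product of multilinear polynomials; it agrees with the polynomial
    -- product whenever the two factors depend on disjoint sets of variables,
    -- which is the only way it is used below.
    _⊗_ : MPoly n → MPoly n → MPoly n
    (p ⊗ q) S = sumC (map (λ A → p A * q (S ─ A)) (subsetsOf S))

    prodF : ∀ {t} → (Fin t → MPoly n) → MPoly n
    prodF {zero} g = oneP
    prodF {suc t} g = g zero ⊗ prodF (λ i → g (suc i))

    SupportedIn : Subset n → MPoly n → Set
    SupportedIn X p = ∀ S → ¬ (S ⊆ X) → p S ≈ 0#

    DegLe1 : MPoly n → Set
    DegLe1 p = ∀ S → 2 N.≤ ∣ S ∣ → p S ≈ 0#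

    IsProduct : ℕ → MPoly n → Set
    IsProduct t f =
      Σ (Fin n → Fin t) λ part → Surjective part ×
      Σ (Fin t → MPoly n) λ g → (∀ i → SupportedIn (block part i) (g i)) ×
      (f ≐ prodF g)

    -- r-simple polynomial: f = L_1 ⋯ L_r' · G, blocks X_1..X_r' (indices
    -- inject₁ i) and X_{r'+1} (index fromℕ r'), |X_1 ∪ … ∪ X_r'| ≥ 400 r.
    IsSimple : ℕ → MPoly n → Set
    IsSimple r f =
      Σ ℕ λ r' → r' N.≤ r ×
      Σ (Fin n → Fin (suc r')) λ part → Surjective part ×
      Σ (Fin r' → MPoly n) λ L → Σ (MPoly n) λ G →
      (∀ i → SupportedIn (block part (inject₁ i)) (L i) × DegLe1 (L i)) ×
      SupportedIn (block part (fromℕ r')) G ×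
      400 N.* r N.≤ ∣ ∁ (block part (fromℕ r')) ∣ ×
      (f ≐ (prodF L ⊗ G))

  data Leaf (n : ℕ) : Set where
    var : Fin n → Leaf n
    const : Carrier → Leaf n

  mutual
    -- SPF n k : a (ΣΠ)^k Σ formula (output: a sum gate), nonempty fan-in.
    data SPF (n : ℕ) : ℕ → Set where
      bottom : Leaf n → List (Leaf n) → SPF n zero
      top : ∀ {k} → PG n k → List (PG n k) → SPF n (suc k)

    data PG (n : ℕ) (k : ℕ) : Set where
      prod : SPF n k → List (SPF n k) → PG n k

  leafVars : ∀ {n} → Leaf n → Subset n
  leafVars (var i) = ⁅ i ⁆
  leafVars (const c) = Sub.⊥

  leavesVars : ∀ {n} → List (Leaf n) → Subset n
  leavesVars [] = Sub.⊥
  leavesVars (l ∷ ls) = leafVars l ∪ leavesVars ls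

  leafEval : ∀ {n} → Leaf n → MPoly n
  leafEval (var i) = varP i
  leafEval (const c) = constP c

  leavesEval : ∀ {n} → List (Leaf n) → MPoly n
  leavesEval [] = zeroP
  leavesEval (l ∷ ls) = leafEval l ⊕ leavesEval ls

  mutual
    -- size = number of gates including inputs
    size : ∀ {n k} → SPF n k → ℕ
    size (bottom l ls) = N.suc (length (l ∷ ls))
    size (top p ps) = N.suc (sizePG p N.+ sizePGs ps)

    sizePGs : ∀ {n k} → List (PG n k) → ℕ
    sizePGs [] = 0
    sizePGs (p ∷ ps) = sizePG p N.+ sizePGs ps

    sizePG : ∀ {n k} → PG n k → ℕ
    sizePG (prod a as) = N.suc (size a N.+ sizes as)

    sizes : ∀ {n k} → List (SPF n k) → ℕ
    sizes [] = 0
    sizes (a ∷ as) = size a N.+ sizes as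

  mutual
    vars : ∀ {n k} → SPF n k → Subset n
    vars (bottom l ls) = leafVars l ∪ leavesVars ls
    vars (top p ps) = varsPG p ∪ varsPGs ps

    varsPGs : ∀ {n k} → List (PG n k) → Subset n
    varsPGs [] = Sub.⊥
    varsPGs (p ∷ ps) = varsPG p ∪ varsPGs ps

    varsPG : ∀ {n k} → PG n k → Subset n
    varsPG (prod a as) = vars a ∪ varsL as

    varsL : ∀ {n k} → List (SPF n k) → Subset n
    varsL [] = Sub.⊥
    varsL (a ∷ as) = vars a ∪ varsL as

  PairwiseDisjoint : ∀ {n k} → List (SPF n k) → Set
  PairwiseDisjoint [] = ⊤
  PairwiseDisjoint (a ∷ as) = Empty (vars a ∩ varsL as) × PairwiseDisjoint as

  mutual
    SynML : ∀ {n k} → SPF n k → Set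
    SynML (bottom l ls) = ⊤
    SynML (top p ps) = SynMLPG p × SynMLPGs ps

    SynMLPGs : ∀ {n k} → List (PG n k) → Set
    SynMLPGs [] = ⊤
    SynMLPGs (p ∷ ps) = SynMLPG p × SynMLPGs ps

    SynMLPG : ∀ {n k} → PG n k → Set
    SynMLPG (prod a as) = PairwiseDisjoint (a ∷ as) × SynML a × SynMLs as

    SynMLs : ∀ {n k} → List (SPF n k) → Set
    SynMLs [] = ⊤
    SynMLs (a ∷ as) = SynML a × SynMLs as

  mutual
    eval : ∀ {n k} → SPF n k → MPoly n
    eval (bottom l ls) = leafEval l ⊕ leavesEval ls
    eval (top p ps) = evalPG p ⊕ evalPGs ps

    evalPGs : ∀ {n k} → List (PG n k) → MPoly n
    evalPGs [] = zeroP
    evalPGs (p ∷ ps) = evalPG p ⊕ evalPGs ps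

    evalPG : ∀ {n k} → PG n k → MPoly n
    evalPG (prod a as) = eval a ⊗ evalL as

    evalL : ∀ {n k} → List (SPF n k) → MPoly n
    evalL [] = oneP
    evalL (a ∷ as) = eval a ⊗ evalL as

{-# OPTIONS --safe #-}
-- Expand the formula from the top, distributing over sum gates, so
-- that every product gate reached yields one summand c · ∏ factors · (that gate).
-- At a product gate the children with variables become factors with disjoint
-- scopes, except the child with the most variables, which is expanded further.
-- Once the factors and the still unused variables give t blocks, the summand is
-- a t-product polynomial. Otherwise fewer than t factors have been set aside;
-- since the followed child keeps at least a 1/k share of the variables of its k
-- nonconstant siblings, the bottom product of linear forms still involves more
-- than 801 t variables, and the summand is t-simple (or, if one linear form
-- involves every variable, a t-simple plus a t-product polynomial). Every
-- summand is charged to a distinct gate, so there are at most s of each kind.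
-- With t least such that Δ ^ Δ * d ≤ (m * t) ^ Δ, the loss of variables along
-- the descent is small enough once d is large.
module Submission where

open import Defs
open import Level using (0ℓ)
open import Algebra.Bundles using (CommutativeSemiring)
import Algebra.Structures.Biased as Biased
import Algebra.Properties.CommutativeSemigroup as CommutativeSemigroupProperties
open import Data.Bool using (if_then_else_)
import Data.Bool.Properties as Bool
open import Data.Empty using (⊥; ⊥-elim)
open import Data.Fin using (Fin; zero; suc; inject₁; fromℕ)
open import Data.Fin.Relation.Unary.Top using (view; ‵fromℕ; ‵inject₁)
import Data.Fin.Properties as Fin
open import Data.Fin.Subset as Subset
  using (Subset; inside; outside; _∈_; _∉_; _⊆_; _∪_; _∩_; _─_; ∁; ⁅_⁆; ∣_∣; Nonempty; Empty)
open import Data.Fin.Subset.Properties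
open import Data.List using (List; []; _∷_; _++_; map; length; lookup)
import Data.List.Properties as List
open import Data.List.Relation.Unary.All as All using (All; []; _∷_)
open import Data.List.Membership.Propositional.Properties using (∈-lookup)
import Data.List.Relation.Unary.All.Properties as All
open import Data.Maybe using (Maybe; just; nothing; maybe′)
import Data.Maybe as Maybe
open import Data.Nat using (ℕ; zero; suc; _≤_; _<_; z≤n; s≤s; pred; NonZero)
import Data.Nat as ℕ
import Data.Nat.Properties as ℕₚ
open import Data.Nat.DivMod using (_/_; _%_; m≡m%n+[m/n]*n; m%n<n)
open import Data.Nat.ListAction using (sum; product)
open import Data.Nat.Solver using (module +-*-Solver)
open import Data.Product using (Σ; ∃; _×_; _,_; proj₁; proj₂)
open import Data.Sum using (inj₁; inj₂; [_,_]′)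
open import Data.Unit using (⊤; tt)
open import Data.Vec using ([]; _∷_; here; there)
open import Data.Vec.Properties using (≡-dec)
import Data.Vec.Properties as Vec
open import Function using (_∘_; id; case_of_)
open import Relation.Binary.PropositionalEquality as ≡ using (_≡_; refl)
import Relation.Binary.Reasoning.Setoid as SetoidReasoning
open import Relation.Binary.Structures using (IsEquivalence)
open import Relation.Nullary using (¬_; does; yes; no)
open import Relation.Unary using (Decidable)

private
  variable
    n : ℕ
    p q r : Subset n

Disjoint : Subset n → Subset n → Set
Disjoint p q = ∀ {x} → x ∈ p → x ∈ q → ⊥

Disjoint-sym : Disjoint p q → Disjoint q p
Disjoint-sym p#q x∈q x∈p = p#q x∈p x∈q

Disjoint-mono : ∀ {p′ q′ : Subset n} → p′ ⊆ p → q′ ⊆ q → Disjoint p q → Disjoint p′ q′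
Disjoint-mono p′⊆p q′⊆q p#q x∈p′ x∈q′ = p#q (p′⊆p x∈p′) (q′⊆q x∈q′)

Disjoint-∪ : Disjoint p r → Disjoint q r → Disjoint (p ∪ q) r
Disjoint-∪ {p = p} {q = q} p#r q#r x∈p∪q with x∈p∪q⁻ p q x∈p∪q
... | inj₁ x∈p = p#r x∈p
... | inj₂ x∈q = q#r x∈q

Empty∩⇒Disjoint : Empty (p ∩ q) → Disjoint p q
Empty∩⇒Disjoint empty x∈p x∈q = empty (_ , x∈p∩q⁺ (x∈p , x∈q))

∪-least : p ⊆ r → q ⊆ r → p ∪ q ⊆ r
∪-least {p = p} {q = q} p⊆r q⊆r x∈p∪q with x∈p∪q⁻ p q x∈p∪q
... | inj₁ x∈p = p⊆r x∈p
... | inj₂ x∈q = q⊆r x∈q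

∣p∪q∣≤∣p∣+∣q∣ : ∀ (p q : Subset n) → ∣ p ∪ q ∣ ≤ ∣ p ∣ ℕ.+ ∣ q ∣
∣p∪q∣≤∣p∣+∣q∣ []            []            = z≤n
∣p∪q∣≤∣p∣+∣q∣ (outside ∷ p) (outside ∷ q) = ∣p∪q∣≤∣p∣+∣q∣ p q
∣p∪q∣≤∣p∣+∣q∣ (inside  ∷ p) (outside ∷ q) = s≤s (∣p∪q∣≤∣p∣+∣q∣ p q)
∣p∪q∣≤∣p∣+∣q∣ (outside ∷ p) (inside  ∷ q) =
  ℕₚ.≤-trans (s≤s (∣p∪q∣≤∣p∣+∣q∣ p q)) (ℕₚ.≤-reflexive (≡.sym (ℕₚ.+-suc ∣ p ∣ ∣ q ∣)))
∣p∪q∣≤∣p∣+∣q∣ (inside  ∷ p) (inside  ∷ q) =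
  s≤s (ℕₚ.≤-trans (∣p∪q∣≤∣p∣+∣q∣ p q) (ℕₚ.≤-trans (ℕₚ.n≤1+n _) (ℕₚ.≤-reflexive (≡.sym (ℕₚ.+-suc ∣ p ∣ ∣ q ∣)))))

∣∁p∣+∣p∣≡n : ∀ (p : Subset n) → ∣ ∁ p ∣ ℕ.+ ∣ p ∣ ≡ n
∣∁p∣+∣p∣≡n p = ≡.trans (≡.cong (ℕ._+ ∣ p ∣) (∣∁p∣≡n∸∣p∣ p)) (ℕₚ.m∸n+n≡m (∣p∣≤n p))

Disjoint⇒∣p∣+∣q∣≤n : {p q : Subset n} → Disjoint p q → ∣ p ∣ ℕ.+ ∣ q ∣ ≤ n
Disjoint⇒∣p∣+∣q∣≤n {q = q} p#q = ℕₚ.≤-trans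
  (ℕₚ.+-monoˡ-≤ ∣ q ∣ (p⊆q⇒∣p∣≤∣q∣ (λ x∈p → x∉p⇒x∈∁p (p#q x∈p))))
  (ℕₚ.≤-reflexive (∣∁p∣+∣p∣≡n q))

∣p∣≥1⇒Nonempty : ∀ (p : Subset n) → 1 ≤ ∣ p ∣ → Nonempty p
∣p∣≥1⇒Nonempty (inside  ∷ p) _ = zero , here
∣p∣≥1⇒Nonempty (outside ∷ p) 1≤∣p∣ with ∣p∣≥1⇒Nonempty p 1≤∣p∣
... | x , x∈p = suc x , there x∈p

Nonempty⇒∣p∣≥1 : {p : Subset n} → Nonempty p → 1 ≤ ∣ p ∣
Nonempty⇒∣p∣≥1 {p = p} (x , x∈p) = ℕₚ.≤-trans (ℕₚ.≤-reflexive (≡.sym (∣⁅x⁆∣≡1 x)))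
  (p⊆q⇒∣p∣≤∣q∣ (λ y∈⁅x⁆ → ≡.subst (_∈ p) (≡.sym (x∈⁅y⁆⇒x≡y x y∈⁅x⁆)) x∈p))

x∈p∧p⊈⁅x⁆⇒2≤∣p∣ : ∀ {p : Subset n} {x} → x ∈ p → ¬ p ⊆ ⁅ x ⁆ → 2 ≤ ∣ p ∣
x∈p∧p⊈⁅x⁆⇒2≤∣p∣ {p = p} {x} x∈p p⊈⁅x⁆ with nonempty? (p Subset.- x)
... | yes p-x≠∅ = ℕₚ.≤-trans (s≤s (Nonempty⇒∣p∣≥1 p-x≠∅)) (x∈p⇒∣p-x∣<∣p∣ x∈p)
... | no  p-x=∅ = ⊥-elim (p⊈⁅x⁆ p⊆⁅x⁆)
  where
    p⊆⁅x⁆ : p ⊆ ⁅ x ⁆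
    p⊆⁅x⁆ {y} y∈p with y Fin.≟ x
    ... | yes refl = x∈⁅x⁆ x
    ... | no  y≢x  = ⊥-elim (p-x=∅ (y , x∈p∧x≢y⇒x∈p-y y∈p y≢x))

Empty⇒∣p∣≡0 : {p : Subset n} → Empty p → ∣ p ∣ ≡ 0
Empty⇒∣p∣≡0 {n} empty = ≡.trans (≡.cong ∣_∣ (Empty-unique empty)) (∣⊥∣≡0 n)

∣∁⁅x⁆∣+1≡n : ∀ (x : Fin n) → ∣ ∁ ⁅ x ⁆ ∣ ℕ.+ 1 ≡ n
∣∁⁅x⁆∣+1≡n x = ≡.trans (≡.cong (∣ ∁ ⁅ x ⁆ ∣ ℕ.+_) (≡.sym (∣⁅x⁆∣≡1 x))) (∣∁p∣+∣p∣≡n ⁅ x ⁆)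

∣∁p∣≤1+∣∁[⁅x⁆∪p]∣ : ∀ (x : Fin n) p → ∣ ∁ p ∣ ≤ suc ∣ ∁ (⁅ x ⁆ ∪ p) ∣
∣∁p∣≤1+∣∁[⁅x⁆∪p]∣ {n} x p = ℕₚ.+-cancelʳ-≤ ∣ p ∣ _ _ (begin
  ∣ ∁ p ∣ ℕ.+ ∣ p ∣                          ≡⟨ ∣∁p∣+∣p∣≡n p ⟩
  n                                          ≡⟨ ∣∁p∣+∣p∣≡n (⁅ x ⁆ ∪ p) ⟨
  ∣ ∁ (⁅ x ⁆ ∪ p) ∣ ℕ.+ ∣ ⁅ x ⁆ ∪ p ∣        ≤⟨ ℕₚ.+-monoʳ-≤ ∣ ∁ (⁅ x ⁆ ∪ p) ∣ (∣p∪q∣≤∣p∣+∣q∣ ⁅ x ⁆ p) ⟩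
  ∣ ∁ (⁅ x ⁆ ∪ p) ∣ ℕ.+ (∣ ⁅ x ⁆ ∣ ℕ.+ ∣ p ∣) ≡⟨ ≡.cong (λ k → ∣ ∁ (⁅ x ⁆ ∪ p) ∣ ℕ.+ (k ℕ.+ ∣ p ∣)) (∣⁅x⁆∣≡1 x) ⟩
  ∣ ∁ (⁅ x ⁆ ∪ p) ∣ ℕ.+ suc ∣ p ∣             ≡⟨ ℕₚ.+-suc _ _ ⟩
  suc ∣ ∁ (⁅ x ⁆ ∪ p) ∣ ℕ.+ ∣ p ∣             ∎)
  where open ℕₚ.≤-Reasoning

-- Multilinear polynomials form a commutative semiring

module PolynomialSemiring (F : Field) where
  open Field F renaming (refl to ≈-refl; sym to ≈-sym; trans to ≈-trans)
  open Poly F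
  open SetoidReasoning setoid

  δ-at : ∀ (A : Subset n) c → δ A c A ≈ c
  δ-at A c with ≡-dec Bool._≟_ A A
  ... | yes _   = ≈-refl
  ... | no A≢A = ⊥-elim (A≢A refl)

  δ-elsewhere : ∀ (A S : Subset n) c → ¬ S ≡ A → δ A c S ≈ 0#
  δ-elsewhere A S c S≢A with ≡-dec Bool._≟_ S A
  ... | yes S≡A = ⊥-elim (S≢A S≡A)
  ... | no _    = ≈-refl

  -- The implicit index of sumC only records the ambient number of variables.
  sumC-reindex : ∀ {m} xs → sumC {n} xs ≡ sumC {m} xs
  sumC-reindex []       = refl
  sumC-reindex {n} {m} (x ∷ xs) = ≡.cong (x +_) (sumC-reindex {n} {m} xs)

  sumC-++ : ∀ xs ys → sumC {n} (xs ++ ys) ≈ sumC {n} xs + sumC {n} ys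
  sumC-++ []       ys = ≈-sym (+-identityˡ _)
  sumC-++ {n} (x ∷ xs) ys = ≈-trans (+-congˡ (sumC-++ {n} xs ys)) (≈-sym (+-assoc _ _ _))

  module _ {A : Set} where

    sumC-map-cong : ∀ {f g : A → Carrier} → (∀ a → f a ≈ g a) → ∀ xs →
                    sumC {n} (map f xs) ≈ sumC {n} (map g xs)
    sumC-map-cong f≈g []       = ≈-refl
    sumC-map-cong {n} f≈g (x ∷ xs) = +-cong (f≈g x) (sumC-map-cong {n} f≈g xs)

    sumC-map-zero : ∀ {f : A → Carrier} → (∀ a → f a ≈ 0#) → ∀ xs → sumC {n} (map f xs) ≈ 0#
    sumC-map-zero f≈0 []       = ≈-refl
    sumC-map-zero {n} f≈0 (x ∷ xs) = ≈-trans (+-cong (f≈0 x) (sumC-map-zero {n} f≈0 xs)) (+-identityˡ _)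

    sumC-map-+ : ∀ (f g : A → Carrier) xs →
                 sumC {n} (map (λ a → f a + g a) xs) ≈ sumC {n} (map f xs) + sumC {n} (map g xs)
    sumC-map-+ f g []       = ≈-sym (+-identityˡ _)
    sumC-map-+ {n} f g (x ∷ xs) = begin
      (f x + g x) + sumC {n} (map (λ a → f a + g a) xs)
        ≈⟨ +-congˡ (sumC-map-+ {n} f g xs) ⟩
      (f x + g x) + (sumC {n} (map f xs) + sumC {n} (map g xs))
        ≈⟨ CommutativeSemigroupProperties.interchange +-commutativeSemigroup _ _ _ _ ⟩
      (f x + sumC {n} (map f xs)) + (g x + sumC {n} (map g xs)) ∎

    sumC-map-∘ : ∀ {B : Set} {m} (f : B → Carrier) (g : A → B) xs →
                 sumC {n} (map f (map g xs)) ≡ sumC {m} (map (f ∘ g) xs)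
    sumC-map-∘ {n} {m = m} f g xs =
      ≡.trans (≡.cong (sumC {n}) (≡.sym (List.map-∘ xs))) (sumC-reindex {n} {m} (map (f ∘ g) xs))

  ≐-refl : {p : MPoly n} → p ≐ p
  ≐-refl S = ≈-refl

  ≐-sym : {p q : MPoly n} → p ≐ q → q ≐ p
  ≐-sym p≐q S = ≈-sym (p≐q S)

  ≐-trans : {p q r : MPoly n} → p ≐ q → q ≐ r → p ≐ r
  ≐-trans p≐q q≐r S = ≈-trans (p≐q S) (q≐r S)

  ≐-isEquivalence : IsEquivalence (_≐_ {n})
  ≐-isEquivalence = record { refl = ≐-refl ; sym = ≐-sym ; trans = ≐-trans }

  ⊕-cong : ∀ {p p′ q q′ : MPoly n} → p ≐ p′ → q ≐ q′ → (p ⊕ q) ≐ (p′ ⊕ q′)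
  ⊕-cong p≐p′ q≐q′ S = +-cong (p≐p′ S) (q≐q′ S)

  ⊗-cong : ∀ {p p′ q q′ : MPoly n} → p ≐ p′ → q ≐ q′ → (p ⊗ q) ≐ (p′ ⊗ q′)
  ⊗-cong {n} p≐p′ q≐q′ S = sumC-map-cong {n = n} (λ A → *-cong (p≐p′ A) (q≐q′ (S ─ A))) (subsetsOf S)

  ⊗-zeroˡ : ∀ (p : MPoly n) → (zeroP ⊗ p) ≐ zeroP
  ⊗-zeroˡ {n} p S = sumC-map-zero {n = n} (λ A → zeroˡ _) (subsetsOf S)

  ⊗-distribˡ : ∀ (p q r : MPoly n) → (p ⊗ (q ⊕ r)) ≐ ((p ⊗ q) ⊕ (p ⊗ r))
  ⊗-distribˡ {n} p q r S = ≈-trans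
    (sumC-map-cong {n = n} (λ A → distribˡ (p A) (q (S ─ A)) (r (S ─ A))) (subsetsOf S))
    (sumC-map-+ {n = n} _ _ (subsetsOf S))

  ⊗-distribʳ : ∀ (p q r : MPoly n) → ((q ⊕ r) ⊗ p) ≐ ((q ⊗ p) ⊕ (r ⊗ p))
  ⊗-distribʳ {n} p q r S = ≈-trans
    (sumC-map-cong {n = n} (λ A → distribʳ (p (S ─ A)) (q A) (r A)) (subsetsOf S))
    (sumC-map-+ {n = n} _ _ (subsetsOf S))

  -- p ₀ and p ₁ are the parts of p without and with the first variable, as
  -- polynomials in the remaining ones; the semiring laws follow by induction on n.
  infix 30 _₀ _₁
  _₀ _₁ : MPoly (suc n) → MPoly n
  (p ₀) S = p (outside ∷ S)
  (p ₁) S = p (inside ∷ S)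

  ≐-split : ∀ {p q : MPoly (suc n)} → p ₀ ≐ q ₀ → p ₁ ≐ q ₁ → p ≐ q
  ≐-split p₀≐q₀ p₁≐q₁ (outside ∷ S) = p₀≐q₀ S
  ≐-split p₀≐q₀ p₁≐q₁ (inside  ∷ S) = p₁≐q₁ S

  ⊗-₀ : ∀ (p q : MPoly (suc n)) → (p ⊗ q) ₀ ≐ (p ₀ ⊗ q ₀)
  ⊗-₀ {n} p q S = reflexive (sumC-map-∘ {n = suc n} {m = n} _ (outside ∷_) (subsetsOf S))

  ⊗-₁ : ∀ (p q : MPoly (suc n)) → (p ⊗ q) ₁ ≐ ((p ₀ ⊗ q ₁) ⊕ (p ₁ ⊗ q ₀))
  ⊗-₁ {n} p q S = begin
    sumC {suc n} (map f (map (outside ∷_) L ++ map (inside ∷_) L))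
      ≡⟨ ≡.cong (sumC {suc n}) (List.map-++ f (map (outside ∷_) L) (map (inside ∷_) L)) ⟩
    sumC {suc n} (map f (map (outside ∷_) L) ++ map f (map (inside ∷_) L))
      ≈⟨ sumC-++ {suc n} (map f (map (outside ∷_) L)) _ ⟩
    sumC {suc n} (map f (map (outside ∷_) L)) + sumC {suc n} (map f (map (inside ∷_) L))
      ≡⟨ ≡.cong₂ _+_ (sumC-map-∘ {n = suc n} {m = n} f (outside ∷_) L) (sumC-map-∘ {n = suc n} {m = n} f (inside ∷_) L) ⟩
    ((p ₀ ⊗ q ₁) ⊕ (p ₁ ⊗ q ₀)) S ∎
    where
      L = subsetsOf S
      f = λ A → p A * q ((inside ∷ S) ─ A)

  oneP-₀ : (oneP {suc n}) ₀ ≐ oneP {n}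
  oneP-₀ S = ≈-refl

  oneP-₁ : (oneP {suc n}) ₁ ≐ zeroP
  oneP-₁ S = δ-elsewhere Subset.⊥ (inside ∷ S) 1# (λ ())

  ⊗-comm : ∀ (p q : MPoly n) → (p ⊗ q) ≐ (q ⊗ p)
  ⊗-comm {zero}  p q [] = +-congʳ (*-comm _ _)
  ⊗-comm {suc n} p q = ≐-split
    (λ S → begin
      (p ⊗ q) (outside ∷ S) ≈⟨ ⊗-₀ p q S ⟩
      (p ₀ ⊗ q ₀) S         ≈⟨ ⊗-comm (p ₀) (q ₀) S ⟩
      (q ₀ ⊗ p ₀) S         ≈⟨ ⊗-₀ q p S ⟨
      (q ⊗ p) (outside ∷ S) ∎)
    (λ S → begin
      (p ⊗ q) (inside ∷ S)                       ≈⟨ ⊗-₁ p q S ⟩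
      (p ₀ ⊗ q ₁) S + (p ₁ ⊗ q ₀) S              ≈⟨ +-cong (⊗-comm (p ₀) (q ₁) S) (⊗-comm (p ₁) (q ₀) S) ⟩
      (q ₁ ⊗ p ₀) S + (q ₀ ⊗ p ₁) S              ≈⟨ +-comm _ _ ⟩
      (q ₀ ⊗ p ₁) S + (q ₁ ⊗ p ₀) S              ≈⟨ ⊗-₁ q p S ⟨
      (q ⊗ p) (inside ∷ S)                       ∎)

  ⊗-identityˡ : ∀ (p : MPoly n) → (oneP ⊗ p) ≐ p
  ⊗-identityˡ {zero}  p [] = ≈-trans (+-identityʳ _) (≈-trans (*-congʳ (δ-at {0} Subset.⊥ 1#)) (*-identityˡ _))
  ⊗-identityˡ {suc n} p = ≐-split
    (λ S → begin
      (oneP ⊗ p) (outside ∷ S)   ≈⟨ ⊗-₀ oneP p S ⟩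
      (oneP ₀ ⊗ p ₀) S           ≈⟨ ⊗-cong oneP-₀ (≐-refl {p = p ₀}) S ⟩
      (oneP ⊗ p ₀) S             ≈⟨ ⊗-identityˡ (p ₀) S ⟩
      p (outside ∷ S)            ∎)
    (λ S → begin
      (oneP ⊗ p) (inside ∷ S)                      ≈⟨ ⊗-₁ oneP p S ⟩
      (oneP ₀ ⊗ p ₁) S + (oneP ₁ ⊗ p ₀) S          ≈⟨ +-cong (⊗-cong oneP-₀ (≐-refl {p = p ₁}) S) (⊗-cong oneP-₁ (≐-refl {p = p ₀}) S) ⟩
      (oneP ⊗ p ₁) S + (zeroP ⊗ p ₀) S             ≈⟨ +-cong (⊗-identityˡ (p ₁) S) (⊗-zeroˡ (p ₀) S) ⟩
      p (inside ∷ S) + 0#                          ≈⟨ +-identityʳ _ ⟩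
      p (inside ∷ S)                               ∎)

  ⊗-assoc : ∀ (p q r : MPoly n) → ((p ⊗ q) ⊗ r) ≐ (p ⊗ (q ⊗ r))
  ⊗-assoc {zero} p q r [] = begin
    (p [] * q [] + 0#) * r [] + 0#  ≈⟨ +-identityʳ _ ⟩
    (p [] * q [] + 0#) * r []       ≈⟨ *-congʳ (+-identityʳ _) ⟩
    (p [] * q []) * r []            ≈⟨ *-assoc _ _ _ ⟩
    p [] * (q [] * r [])            ≈⟨ *-congˡ (+-identityʳ _) ⟨
    p [] * (q [] * r [] + 0#)       ≈⟨ +-identityʳ _ ⟨
    p [] * (q [] * r [] + 0#) + 0#  ∎
  ⊗-assoc {suc n} p q r = ≐-split
    (λ S → begin
      ((p ⊗ q) ⊗ r) (outside ∷ S)   ≈⟨ ⊗-₀ (p ⊗ q) r S ⟩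
      ((p ⊗ q) ₀ ⊗ r ₀) S           ≈⟨ ⊗-cong (⊗-₀ p q) (≐-refl {p = r ₀}) S ⟩
      ((p ₀ ⊗ q ₀) ⊗ r ₀) S         ≈⟨ ⊗-assoc (p ₀) (q ₀) (r ₀) S ⟩
      (p ₀ ⊗ (q ₀ ⊗ r ₀)) S         ≈⟨ ⊗-cong (≐-refl {p = p ₀}) (⊗-₀ q r) S ⟨
      (p ₀ ⊗ (q ⊗ r) ₀) S           ≈⟨ ⊗-₀ p (q ⊗ r) S ⟨
      (p ⊗ (q ⊗ r)) (outside ∷ S)   ∎)
    (λ S → begin
      ((p ⊗ q) ⊗ r) (inside ∷ S)
        ≈⟨ ⊗-₁ (p ⊗ q) r S ⟩
      ((p ⊗ q) ₀ ⊗ r ₁) S + ((p ⊗ q) ₁ ⊗ r ₀) S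
        ≈⟨ +-cong (⊗-cong (⊗-₀ p q) (≐-refl {p = r ₁}) S) (⊗-cong (⊗-₁ p q) (≐-refl {p = r ₀}) S) ⟩
      ((p ₀ ⊗ q ₀) ⊗ r ₁) S + (((p ₀ ⊗ q ₁) ⊕ (p ₁ ⊗ q ₀)) ⊗ r ₀) S
        ≈⟨ +-congˡ (⊗-distribʳ (r ₀) (p ₀ ⊗ q ₁) (p ₁ ⊗ q ₀) S) ⟩
      ((p ₀ ⊗ q ₀) ⊗ r ₁) S + (((p ₀ ⊗ q ₁) ⊗ r ₀) S + ((p ₁ ⊗ q ₀) ⊗ r ₀) S)
        ≈⟨ +-cong (⊗-assoc (p ₀) (q ₀) (r ₁) S) (+-cong (⊗-assoc (p ₀) (q ₁) (r ₀) S) (⊗-assoc (p ₁) (q ₀) (r ₀) S)) ⟩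
      (p ₀ ⊗ (q ₀ ⊗ r ₁)) S + ((p ₀ ⊗ (q ₁ ⊗ r ₀)) S + (p ₁ ⊗ (q ₀ ⊗ r ₀)) S)
        ≈⟨ +-assoc _ _ _ ⟨
      ((p ₀ ⊗ (q ₀ ⊗ r ₁)) S + (p ₀ ⊗ (q ₁ ⊗ r ₀)) S) + (p ₁ ⊗ (q ₀ ⊗ r ₀)) S
        ≈⟨ +-congʳ (⊗-distribˡ (p ₀) (q ₀ ⊗ r ₁) (q ₁ ⊗ r ₀) S) ⟨
      (p ₀ ⊗ ((q ₀ ⊗ r ₁) ⊕ (q ₁ ⊗ r ₀))) S + (p ₁ ⊗ (q ₀ ⊗ r ₀)) S
        ≈⟨ +-cong (⊗-cong (≐-refl {p = p ₀}) (⊗-₁ q r) S) (⊗-cong (≐-refl {p = p ₁}) (⊗-₀ q r) S) ⟨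
      (p ₀ ⊗ (q ⊗ r) ₁) S + (p ₁ ⊗ (q ⊗ r) ₀) S
        ≈⟨ ⊗-₁ p (q ⊗ r) S ⟨
      (p ⊗ (q ⊗ r)) (inside ∷ S) ∎)

  polynomialSemiring : ℕ → CommutativeSemiring 0ℓ 0ℓ
  polynomialSemiring n = record
    { Carrier = MPoly n
    ; _≈_ = _≐_
    ; _+_ = _⊕_
    ; _*_ = _⊗_
    ; 0# = zeroP
    ; 1# = oneP
    ; isCommutativeSemiring = Biased.isCommutativeSemiringˡ record
      { +-isCommutativeMonoid = Biased.isCommutativeMonoidˡ record
        { isSemigroup = record
          { isMagma = record { isEquivalence = ≐-isEquivalence {n} ; ∙-cong = ⊕-cong }
          ; assoc   = λ p q r S → +-assoc _ _ _
          }
        ; identityˡ = λ p S → +-identityˡ _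
        ; comm      = λ p q S → +-comm _ _
        }
      ; *-isCommutativeMonoid = Biased.isCommutativeMonoidˡ record
        { isSemigroup = record
          { isMagma = record { isEquivalence = ≐-isEquivalence {n} ; ∙-cong = ⊗-cong }
          ; assoc   = ⊗-assoc
          }
        ; identityˡ = ⊗-identityˡ
        ; comm      = ⊗-comm
        }
      ; distribʳ = ⊗-distribʳ
      ; zeroˡ    = ⊗-zeroˡ
      }
    }

  module _ {n : ℕ} where
    open CommutativeSemiring (polynomialSemiring n) public
      using ()
      renaming ( +-assoc to ⊕-assoc; +-identityˡ to ⊕-identityˡ; +-identityʳ to ⊕-identityʳ
               ; *-identityʳ to ⊗-identityʳ; zeroʳ to ⊗-zeroʳ)

  module ⊕-Properties {n} = CommutativeSemigroupProperties
    (CommutativeSemiring.+-commutativeSemigroup (polynomialSemiring n))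
  module ⊗-Properties {n} = CommutativeSemigroupProperties
    (CommutativeSemiring.*-commutativeSemigroup (polynomialSemiring n))

module Support (F : Field) where
  open Field F renaming (refl to ≈-refl; sym to ≈-sym; trans to ≈-trans)
  open Poly F
  open PolynomialSemiring F

  Constant : MPoly n → Set
  Constant = SupportedIn Subset.⊥

  SupportedIn-mono : ∀ {X Y : Subset n} {p} → X ⊆ Y → SupportedIn X p → SupportedIn Y p
  SupportedIn-mono X⊆Y p∈X S S⊈Y = p∈X S (λ S⊆X → S⊈Y (X⊆Y ∘ S⊆X))

  SupportedIn-⊕ : ∀ {X Y : Subset n} {p q} → SupportedIn X p → SupportedIn Y q → SupportedIn (X ∪ Y) (p ⊕ q)
  SupportedIn-⊕ {X = X} {Y} p∈X q∈Y S S⊈X∪Y = ≈-trans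
    (+-cong (SupportedIn-mono (p⊆p∪q Y) p∈X S S⊈X∪Y) (SupportedIn-mono (q⊆p∪q X Y) q∈Y S S⊈X∪Y))
    (+-identityˡ _)

  -- A term p A * q (S ─ A) of the coefficient of S vanishes unless S ⊆ X ∪ Y.
  SupportedIn-⊗ : ∀ {X Y : Subset n} {p q} → SupportedIn X p → SupportedIn Y q → SupportedIn (X ∪ Y) (p ⊗ q)
  SupportedIn-⊗ {n} {X} {Y} {p} {q} p∈X q∈Y S S⊈X∪Y = sumC-map-zero {n = n} term (subsetsOf S)
    where
      S⊆A∪S─A : ∀ A → S ⊆ A ∪ (S ─ A)
      S⊆A∪S─A A {x} x∈S with x ∈? A
      ... | yes x∈A = x∈p∪q⁺ (inj₁ x∈A)
      ... | no x∉A  = x∈p∪q⁺ (inj₂ (x∈p∧x∉q⇒x∈p─q x∈S x∉A))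

      term : ∀ A → p A * q (S ─ A) ≈ 0#
      term A with A ⊆? X | (S ─ A) ⊆? Y
      ... | no A⊈X  | _         = ≈-trans (*-congʳ (p∈X A A⊈X)) (zeroˡ _)
      ... | yes _   | no S─A⊈Y = ≈-trans (*-congˡ (q∈Y _ S─A⊈Y)) (zeroʳ _)
      ... | yes A⊆X | yes S─A⊆Y =
        ⊥-elim (S⊈X∪Y (⊆-trans (S⊆A∪S─A A) (∪-least (⊆-trans A⊆X (p⊆p∪q Y)) (⊆-trans S─A⊆Y (q⊆p∪q X Y)))))

  SupportedIn-δ : ∀ (X : Subset n) c → SupportedIn X (δ X c)
  SupportedIn-δ X c S S⊈X = δ-elsewhere X S c (λ S≡X → S⊈X (⊆-reflexive S≡X))

  SupportedIn-zeroP : ∀ (X : Subset n) → SupportedIn X zeroP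
  SupportedIn-zeroP X S _ = ≈-refl

  SupportedIn-oneP : ∀ (X : Subset n) → SupportedIn X oneP
  SupportedIn-oneP X = SupportedIn-mono ⊥⊆ (SupportedIn-δ Subset.⊥ 1#)

  avoiding containing : Fin n → MPoly n → MPoly n
  avoiding   x p S = if does (x ∈? S) then 0# else p S
  containing x p S = if does (x ∈? S) then p S else 0#

  avoiding⊕containing : ∀ x (p : MPoly n) → p ≐ (avoiding x p ⊕ containing x p)
  avoiding⊕containing x p S with x ∈? S
  ... | yes _ = ≈-sym (+-identityˡ _)
  ... | no _  = ≈-sym (+-identityʳ _)

  avoiding-supportedIn : ∀ x (p : MPoly n) → SupportedIn (∁ ⁅ x ⁆) (avoiding x p)
  avoiding-supportedIn x p S S⊈∁⁅x⁆ with x ∈? S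
  ... | yes _  = ≈-refl
  ... | no x∉S = ⊥-elim (S⊈∁⁅x⁆ λ {y} y∈S →
    x∉p⇒x∈∁p λ y∈⁅x⁆ → x∉S (≡.subst (_∈ S) (x∈⁅y⁆⇒x≡y x y∈⁅x⁆) y∈S))

  avoiding-DegLe1 : ∀ x {p : MPoly n} → DegLe1 p → DegLe1 (avoiding x p)
  avoiding-DegLe1 x p-lin S 2≤∣S∣ with x ∈? S
  ... | yes _ = ≈-refl
  ... | no _  = p-lin S 2≤∣S∣

  containing-supportedIn : ∀ x {p : MPoly n} → DegLe1 p → SupportedIn ⁅ x ⁆ (containing x p)
  containing-supportedIn x p-lin S S⊈⁅x⁆ with x ∈? S
  ... | yes x∈S = p-lin S (x∈p∧p⊈⁅x⁆⇒2≤∣p∣ x∈S S⊈⁅x⁆)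
  ... | no _    = ≈-refl

  Constant-⊗ : ∀ {p q : MPoly n} → Constant p → Constant q → Constant (p ⊗ q)
  Constant-⊗ p-const q-const = SupportedIn-mono (∪-least id id) (SupportedIn-⊗ p-const q-const)

  leaf-supportedIn : ∀ (l : Leaf n) → SupportedIn (leafVars l) (leafEval l)
  leaf-supportedIn (var i)   = SupportedIn-δ ⁅ i ⁆ 1#
  leaf-supportedIn (const c) = SupportedIn-δ Subset.⊥ c

  leaves-supportedIn : ∀ (ls : List (Leaf n)) → SupportedIn (leavesVars ls) (leavesEval ls)
  leaves-supportedIn []       = SupportedIn-zeroP _
  leaves-supportedIn (l ∷ ls) = SupportedIn-⊕ (leaf-supportedIn l) (leaves-supportedIn ls)

  mutual
    eval-supportedIn : ∀ {k} (a : SPF n k) → SupportedIn (vars a) (eval a)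
    eval-supportedIn (bottom l ls) = SupportedIn-⊕ (leaf-supportedIn l) (leaves-supportedIn ls)
    eval-supportedIn (top p ps)    = SupportedIn-⊕ (evalPG-supportedIn p) (evalPGs-supportedIn ps)

    evalPGs-supportedIn : ∀ {k} (ps : List (PG n k)) → SupportedIn (varsPGs ps) (evalPGs ps)
    evalPGs-supportedIn []       = SupportedIn-zeroP _
    evalPGs-supportedIn (p ∷ ps) = SupportedIn-⊕ (evalPG-supportedIn p) (evalPGs-supportedIn ps)

    evalPG-supportedIn : ∀ {k} (p : PG n k) → SupportedIn (varsPG p) (evalPG p)
    evalPG-supportedIn (prod a as) = SupportedIn-⊗ (eval-supportedIn a) (evalL-supportedIn as)

    evalL-supportedIn : ∀ {k} (as : List (SPF n k)) → SupportedIn (varsL as) (evalL as)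
    evalL-supportedIn []       = SupportedIn-oneP _
    evalL-supportedIn (a ∷ as) = SupportedIn-⊗ (eval-supportedIn a) (evalL-supportedIn as)

  DegLe1-⊕ : ∀ {p q : MPoly n} → DegLe1 p → DegLe1 q → DegLe1 (p ⊕ q)
  DegLe1-⊕ p-lin q-lin S 2≤∣S∣ = ≈-trans (+-cong (p-lin S 2≤∣S∣) (q-lin S 2≤∣S∣)) (+-identityˡ _)

  DegLe1-δ : ∀ {A : Subset n} c → ∣ A ∣ ≤ 1 → DegLe1 (δ A c)
  DegLe1-δ {A = A} c ∣A∣≤1 S 2≤∣S∣ =
    δ-elsewhere A S c (λ { refl → ℕₚ.<⇒≱ 2≤∣S∣ ∣A∣≤1 })

  leaf-DegLe1 : ∀ (l : Leaf n) → DegLe1 (leafEval l)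
  leaf-DegLe1 (var i)   = DegLe1-δ 1# (ℕₚ.≤-reflexive (∣⁅x⁆∣≡1 i))
  leaf-DegLe1 {n} (const c) = DegLe1-δ c (ℕₚ.≤-trans (ℕₚ.≤-reflexive (∣⊥∣≡0 n)) z≤n)

  leaves-DegLe1 : ∀ (ls : List (Leaf n)) → DegLe1 (leavesEval ls)
  leaves-DegLe1 []       S _ = ≈-refl
  leaves-DegLe1 (l ∷ ls) = DegLe1-⊕ (leaf-DegLe1 l) (leaves-DegLe1 ls)

  eval-DegLe1 : ∀ (a : SPF n 0) → DegLe1 (eval a)
  eval-DegLe1 (bottom l ls) = DegLe1-⊕ (leaf-DegLe1 l) (leaves-DegLe1 ls)

-- Products of factors with disjoint scopes

module Factorisation (F : Field) where
  open Poly F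
  open PolynomialSemiring F
  open Support F

  record Factor (n : ℕ) : Set where
    constructor factor
    field
      poly  : MPoly n
      scope : Subset n
  open Factor public

  scopes : List (Factor n) → Subset n
  scopes []       = Subset.⊥
  scopes (f ∷ fs) = scope f ∪ scopes fs

  ∏ : List (Factor n) → MPoly n
  ∏ []       = oneP
  ∏ (f ∷ fs) = poly f ⊗ ∏ fs

  Separated : List (Factor n) → Set
  Separated []       = ⊤
  Separated (f ∷ fs) =
    Nonempty (scope f) × SupportedIn (scope f) (poly f) × Disjoint (scope f) (scopes fs) × Separated fs

  IsProduct-cong : ∀ {t} {h h′ : MPoly n} → h ≐ h′ → IsProduct t h′ → IsProduct t h
  IsProduct-cong h≐h′ (part , surj , g , g-supp , h′≐g) = part , surj , g , g-supp , ≐-trans h≐h′ h′≐g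

  IsSimple-cong : ∀ {t} {h h′ : MPoly n} → h ≐ h′ → IsSimple t h′ → IsSimple t h
  IsSimple-cong h≐h′ (r , r≤t , part , surj , L , G , L-supp , G-supp , big , h′≐LG) =
    r , r≤t , part , surj , L , G , L-supp , G-supp , big , ≐-trans h≐h′ h′≐LG

  scope⊆scopes : ∀ (fs : List (Factor n)) i → scope (lookup fs i) ⊆ scopes fs
  scope⊆scopes (f ∷ fs) zero    = p⊆p∪q (scopes fs)
  scope⊆scopes (f ∷ fs) (suc i) = ⊆-trans (scope⊆scopes fs i) (q⊆p∪q (scope f) (scopes fs))

  ∈scopes⇒∈scope : ∀ (fs : List (Factor n)) {x} → x ∈ scopes fs → ∃ λ i → x ∈ scope (lookup fs i)
  ∈scopes⇒∈scope []       x∈ = ⊥-elim (∉⊥ x∈)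
  ∈scopes⇒∈scope (f ∷ fs) x∈ with x∈p∪q⁻ (scope f) (scopes fs) x∈
  ... | inj₁ x∈f  = zero , x∈f
  ... | inj₂ x∈fs = let i , x∈i = ∈scopes⇒∈scope fs x∈fs in suc i , x∈i

  Separated-lookup : ∀ {fs : List (Factor n)} → Separated fs → ∀ i →
                     Nonempty (scope (lookup fs i)) × SupportedIn (scope (lookup fs i)) (poly (lookup fs i))
  Separated-lookup {fs = f ∷ fs} (ne , supp , _ , _)   zero    = ne , supp
  Separated-lookup {fs = f ∷ fs} (_ , _ , _ , fs-sep) (suc i) = Separated-lookup fs-sep i

  prodF-lookup : ∀ (fs : List (Factor n)) → prodF (poly ∘ lookup fs) ≐ ∏ fs
  prodF-lookup []       = ≐-refl
  prodF-lookup (f ∷ fs) = ⊗-cong (≐-refl {p = poly f}) (prodF-lookup fs)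

  ∏-supportedIn : ∀ {fs : List (Factor n)} → Separated fs → SupportedIn (scopes fs) (∏ fs)
  ∏-supportedIn {fs = []}     _                     = SupportedIn-oneP _
  ∏-supportedIn {fs = f ∷ fs} (_ , supp , _ , fs-sep) = SupportedIn-⊗ supp (∏-supportedIn fs-sep)

  ∈-block⁺ : ∀ {t} (part : Fin n → Fin t) {x i} → part x ≡ i → x ∈ block part i
  ∈-block⁺ part {x} {i} part-x≡i = Vec.lookup⇒[]= x _ (≡.trans (Vec.lookup∘tabulate _ x) inside-if)
    where
      inside-if : (if does (part x Fin.≟ i) then inside else outside) ≡ inside
      inside-if with part x Fin.≟ i
      ... | yes _        = refl
      ... | no part-x≢i  = ⊥-elim (part-x≢i part-x≡i)

  ∈-block⁻ : ∀ {t} (part : Fin n → Fin t) {x i} → x ∈ block part i → part x ≡ i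
  ∈-block⁻ part {x} {i} x∈ = from-if (≡.trans (≡.sym (Vec.lookup∘tabulate _ x)) (Vec.[]=⇒lookup x∈))
    where
      from-if : (if does (part x Fin.≟ i) then inside else outside) ≡ inside → part x ≡ i
      from-if _ with part x Fin.≟ i
      from-if _  | yes part-x≡i = part-x≡i
      from-if () | no _

  module Partition (fs : List (Factor n)) (fs-sep : Separated fs)
                   {t} (index : Fin (length fs) → Fin t) (default : Fin t) where

    locate : (gs : List (Factor n)) → Fin n → Maybe (Fin (length gs))
    locate []       x = nothing
    locate (g ∷ gs) x with x ∈? scope g
    ... | yes _ = just zero
    ... | no _  = Maybe.map suc (locate gs x)

    locate-scope : ∀ {gs : List (Factor n)} → Separated gs → ∀ i {x} → x ∈ scope (lookup gs i) → locate gs x ≡ just i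
    locate-scope {gs = g ∷ gs} _ zero {x} x∈g with x ∈? scope g
    ... | yes _   = refl
    ... | no x∉g  = ⊥-elim (x∉g x∈g)
    locate-scope {gs = g ∷ gs} (_ , _ , g#gs , gs-sep) (suc i) {x} x∈i with x ∈? scope g
    ... | yes x∈g = ⊥-elim (g#gs x∈g (scope⊆scopes gs i x∈i))
    ... | no _    = ≡.cong (Maybe.map suc) (locate-scope gs-sep i x∈i)

    locate-outside : ∀ (gs : List (Factor n)) {x} → x ∉ scopes gs → locate gs x ≡ nothing
    locate-outside []       _   = refl
    locate-outside (g ∷ gs) {x} x∉ with x ∈? scope g
    ... | yes x∈g = ⊥-elim (x∉ (p⊆p∪q (scopes gs) x∈g))
    ... | no _    = ≡.cong (Maybe.map suc) (locate-outside gs (x∉ ∘ q⊆p∪q (scope g) (scopes gs)))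

    part : Fin n → Fin t
    part x = maybe′ index default (locate fs x)

    part-scope : ∀ i {x} → x ∈ scope (lookup fs i) → part x ≡ index i
    part-scope i x∈i rewrite locate-scope fs-sep i x∈i = refl

    part-outside : ∀ {x} → x ∉ scopes fs → part x ≡ default
    part-outside x∉ rewrite locate-outside fs x∉ = refl

    part-hits : ∀ i → ∃ λ x → part x ≡ index i
    part-hits i = let x , x∈i = proj₁ (Separated-lookup fs-sep i) in x , part-scope i x∈i

    factor-in-block : ∀ i → SupportedIn (block part (index i)) (poly (lookup fs i))
    factor-in-block i =
      SupportedIn-mono (∈-block⁺ part ∘ part-scope i) (proj₂ (Separated-lookup fs-sep i))

  ∏-isProduct : ∀ f (fs : List (Factor n)) → Separated (f ∷ fs) → IsProduct (suc (length fs)) (∏ (f ∷ fs))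
  ∏-isProduct f fs sep = part , part-hits , poly ∘ lookup (f ∷ fs) , factor-in-block , ≐-sym (prodF-lookup (f ∷ fs))
    where open Partition (f ∷ fs) sep id zero

  Separated-absorb : ∀ {f} {fs : List (Factor n)} {c} → Constant c → Separated (f ∷ fs) →
                     Separated (factor (c ⊗ poly f) (scope f) ∷ fs)
  Separated-absorb c-const (ne , supp , f#fs , fs-sep) =
    ne , SupportedIn-mono (∪-least ⊥⊆ id) (SupportedIn-⊗ c-const supp) , f#fs , fs-sep

  Separated-merge : ∀ {f₁ f₂} {fs : List (Factor n)} → Separated (f₁ ∷ f₂ ∷ fs) →
                    Separated (factor (poly f₁ ⊗ poly f₂) (scope f₁ ∪ scope f₂) ∷ fs)
  Separated-merge {f₂ = f₂} ((x , x∈f₁) , supp₁ , f₁#f₂fs , _ , supp₂ , f₂#fs , fs-sep) =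
    (x , p⊆p∪q (scope f₂) x∈f₁) , SupportedIn-⊗ supp₁ supp₂ ,
    Disjoint-∪ (Disjoint-mono id (q⊆p∪q (scope f₂) _) f₁#f₂fs) f₂#fs , fs-sep

  Separated-pad : ∀ {fs : List (Factor n)} {x} → x ∉ scopes fs → Separated fs →
                  Separated (factor oneP ⁅ x ⁆ ∷ fs)
  Separated-pad {fs = fs} {x} x∉ fs-sep =
    (x , x∈⁅x⁆ x) , SupportedIn-oneP _ ,
    (λ y∈⁅x⁆ y∈fs → x∉ (≡.subst (_∈ scopes fs) (x∈⁅y⁆⇒x≡y x y∈⁅x⁆) y∈fs)) , fs-sep

  Separated-swap : ∀ {f₁ f₂} {fs : List (Factor n)} → Separated (f₁ ∷ f₂ ∷ fs) → Separated (f₂ ∷ f₁ ∷ fs)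
  Separated-swap {f₁ = f₁} {f₂} {fs} (ne₁ , supp₁ , f₁#f₂fs , ne₂ , supp₂ , f₂#fs , fs-sep) =
    ne₂ , supp₂ , Disjoint-sym (Disjoint-∪ (Disjoint-mono id (p⊆p∪q (scopes fs)) f₁#f₂fs) (Disjoint-sym f₂#fs)) ,
    ne₁ , supp₁ , Disjoint-mono id (q⊆p∪q (scope f₂) (scopes fs)) f₁#f₂fs , fs-sep

  scopes-swap : ∀ f₁ f₂ (fs : List (Factor n)) → scopes (f₂ ∷ f₁ ∷ fs) ⊆ scopes (f₁ ∷ f₂ ∷ fs)
  scopes-swap f₁ f₂ fs = ∪-least (⊆-trans (p⊆p∪q (scopes fs)) (q⊆p∪q (scope f₁) _))
                                 (∪-least (p⊆p∪q _) (⊆-trans (q⊆p∪q (scope f₂) (scopes fs)) (q⊆p∪q (scope f₁) _)))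

  ∏-swap : ∀ f₁ f₂ (fs : List (Factor n)) → ∏ (f₂ ∷ f₁ ∷ fs) ≐ ∏ (f₁ ∷ f₂ ∷ fs)
  ∏-swap f₁ f₂ fs = ⊗-Properties.x∙yz≈y∙xz (poly f₂) (poly f₁) (∏ fs)

  scopes-++ : ∀ (fs gs : List (Factor n)) → scopes (fs ++ gs) ⊆ scopes fs ∪ scopes gs
  scopes-++ []       gs = q⊆p∪q Subset.⊥ (scopes gs)
  scopes-++ (f ∷ fs) gs = ∪-least (⊆-trans (p⊆p∪q (scopes fs)) (p⊆p∪q (scopes gs)))
    (⊆-trans (scopes-++ fs gs) (∪-least (⊆-trans (q⊆p∪q (scope f) (scopes fs)) (p⊆p∪q (scopes gs))) (q⊆p∪q _ _)))

  Separated-++ : ∀ {fs gs : List (Factor n)} → Separated fs → Separated gs → Disjoint (scopes fs) (scopes gs) →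
                 Separated (fs ++ gs)
  Separated-++ {fs = []}     _                         gs-sep _     = gs-sep
  Separated-++ {fs = f ∷ fs} {gs} (ne , supp , f#fs , fs-sep) gs-sep fs#gs =
    ne , supp ,
    Disjoint-mono id (scopes-++ fs gs) (Disjoint-sym (Disjoint-∪ (Disjoint-sym f#fs)
      (Disjoint-sym (Disjoint-mono (p⊆p∪q (scopes fs)) id fs#gs)))) ,
    Separated-++ fs-sep gs-sep (Disjoint-mono (q⊆p∪q (scope f) (scopes fs)) id fs#gs)

  ∏-++ : ∀ (fs gs : List (Factor n)) → ∏ (fs ++ gs) ≐ (∏ fs ⊗ ∏ gs)
  ∏-++ []       gs = ≐-sym (⊗-identityˡ (∏ gs))
  ∏-++ (f ∷ fs) gs = ≐-trans (⊗-cong (≐-refl {p = poly f}) (∏-++ fs gs)) (≐-sym (⊗-assoc (poly f) (∏ fs) (∏ gs)))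

  Resized : ℕ → List (Factor n) → Set
  Resized t fs = Σ (List (Factor _)) λ fs′ → Separated fs′ × length fs′ ≡ t × ∏ fs′ ≐ ∏ fs

  shrink : ∀ k {t} (fs : List (Factor n)) → Separated fs → length fs ≡ k ℕ.+ suc t → Resized (suc t) fs
  shrink zero    fs             sep len = fs , sep , len , ≐-refl
  shrink (suc k) (f₁ ∷ [])      sep len = ⊥-elim (ℕₚ.0≢1+n (≡.trans (ℕₚ.suc-injective len) (ℕₚ.+-suc k _)))
  shrink (suc k) (f₁ ∷ f₂ ∷ fs) sep len =
    let fs′ , sep′ , len′ , ∏≐ = shrink k _ (Separated-merge sep) (ℕₚ.suc-injective len)
    in fs′ , sep′ , len′ , ≐-trans ∏≐ (⊗-assoc (poly f₁) (poly f₂) (∏ fs))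

  grow : ∀ j (fs : List (Factor n)) → Separated fs → j ≤ ∣ ∁ (scopes fs) ∣ → Resized (j ℕ.+ length fs) fs
  grow zero    fs sep _ = fs , sep , refl , ≐-refl
  grow (suc j) fs sep j<∣∁fs∣ =
    let x , x∈∁fs        = ∣p∣≥1⇒Nonempty _ (ℕₚ.≤-trans (s≤s z≤n) j<∣∁fs∣)
        j≤               = ℕₚ.≤-pred (ℕₚ.≤-trans j<∣∁fs∣ (∣∁p∣≤1+∣∁[⁅x⁆∪p]∣ x (scopes fs)))
        fs′ , sep′ , len′ , ∏≐ = grow j (factor oneP ⁅ x ⁆ ∷ fs) (Separated-pad (x∈∁p⇒x∉p x∈∁fs) sep) j≤
    in fs′ , sep′ , ≡.trans len′ (ℕₚ.+-suc j (length fs)) , ≐-trans ∏≐ (⊗-identityˡ (∏ fs))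

  resize : ∀ {t} (fs : List (Factor n)) → Separated fs → suc t ≤ length fs ℕ.+ ∣ ∁ (scopes fs) ∣ →
           Resized (suc t) fs
  resize {t = t} fs sep t≤ with suc t ℕ.≤? length fs
  ... | yes t<len = shrink (length fs ℕ.∸ suc t) fs sep (≡.sym (ℕₚ.m∸n+n≡m t<len))
  ... | no  t≮len =
    let len≤t = ℕₚ.≤-trans (ℕₚ.n≤1+n _) (ℕₚ.≰⇒> t≮len)
        fs′ , sep′ , len′ , ∏≐ = grow (suc t ℕ.∸ length fs) fs sep
          (ℕₚ.+-cancelˡ-≤ (length fs) _ _ (ℕₚ.≤-trans (ℕₚ.≤-reflexive (ℕₚ.m+[n∸m]≡n len≤t)) t≤))
    in fs′ , sep′ , ≡.trans len′ (ℕₚ.m∸n+n≡m len≤t) , ∏≐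

  product-isProduct : ∀ {t c} (fs : List (Factor n)) → Separated fs → Constant c → 1 ≤ t →
                      t ≤ length fs ℕ.+ ∣ ∁ (scopes fs) ∣ → IsProduct t (c ⊗ ∏ fs)
  product-isProduct {t = suc t} {c} fs sep c-const _ t≤ with resize fs sep t≤
  ... | f ∷ fs′ , sep′ , refl , ∏≐ = IsProduct-cong
    (≐-trans (⊗-cong (≐-refl {p = c}) (≐-sym ∏≐)) (≐-sym (⊗-assoc c (poly f) (∏ fs′))))
    (∏-isProduct _ fs′ (Separated-absorb c-const sep′))

  factors-isSimple : ∀ {t} {G : MPoly n} {V} (Ls : List (Factor n)) → Separated Ls → All (DegLe1 ∘ poly) Ls →
                     SupportedIn V G → Disjoint V (scopes Ls) → Nonempty (∁ (scopes Ls)) →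
                     400 ℕ.* t ≤ ∣ scopes Ls ∣ → length Ls ≤ t → IsSimple t (∏ Ls ⊗ G)
  factors-isSimple {G = G} {V} Ls sep lin G-supp V#Ls (y , y∈∁) big len =
    length Ls , len , part , surj , poly ∘ lookup Ls , G , L-ok , G-ok ,
    ℕₚ.≤-trans big (p⊆q⇒∣p∣≤∣q∣ scopes⊆∁last) , ⊗-cong (≐-sym (prodF-lookup Ls)) (≐-refl {p = G})
    where
      open Partition Ls sep inject₁ (fromℕ (length Ls))

      surj : Surjective part
      surj i with view i
      ... | ‵fromℕ     = y , part-outside (x∈∁p⇒x∉p y∈∁)
      ... | ‵inject₁ j = part-hits j

      L-ok : ∀ i → SupportedIn (block part (inject₁ i)) (poly (lookup Ls i)) × DegLe1 (poly (lookup Ls i))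
      L-ok i = factor-in-block i , All.lookup lin (∈-lookup i)

      G-ok : SupportedIn (block part (fromℕ (length Ls))) G
      G-ok = SupportedIn-mono (λ x∈V → ∈-block⁺ part (part-outside (V#Ls x∈V))) G-supp

      scopes⊆∁last : scopes Ls ⊆ ∁ (block part (fromℕ (length Ls)))
      scopes⊆∁last x∈ with ∈scopes⇒∈scope Ls x∈
      ... | i , x∈i = x∉p⇒x∈∁p λ x∈last →
        Fin.fromℕ≢inject₁ (≡.trans (≡.sym (∈-block⁻ part x∈last)) (part-scope i x∈i))

module Children (F : Field) where
  open Poly F
  open PolynomialSemiring F
  open Support F
  open Factorisation F

  private
    variable
      k : ℕ

  nonconstant : List (SPF n k) → List (Factor n)
  nonconstant []       = []
  nonconstant (a ∷ as) with nonempty? (vars a)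
  ... | yes _ = factor (eval a) (vars a) ∷ nonconstant as
  ... | no _  = nonconstant as

  constantPart : List (SPF n k) → MPoly n
  constantPart []       = oneP
  constantPart (a ∷ as) with nonempty? (vars a)
  ... | yes _ = constantPart as
  ... | no _  = eval a ⊗ constantPart as

  scopes-nonconstant : ∀ (as : List (SPF n k)) → scopes (nonconstant as) ⊆ varsL as
  scopes-nonconstant []       = id
  scopes-nonconstant (a ∷ as) with nonempty? (vars a)
  ... | yes _ = ∪-least (p⊆p∪q (varsL as)) (⊆-trans (scopes-nonconstant as) (q⊆p∪q (vars a) (varsL as)))
  ... | no _  = ⊆-trans (scopes-nonconstant as) (q⊆p∪q (vars a) (varsL as))

  varsL⊆scopes-nonconstant : ∀ (as : List (SPF n k)) → varsL as ⊆ scopes (nonconstant as)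
  varsL⊆scopes-nonconstant []       = id
  varsL⊆scopes-nonconstant (a ∷ as) with nonempty? (vars a)
  ... | yes _ = ∪-least (p⊆p∪q _) (⊆-trans (varsL⊆scopes-nonconstant as) (q⊆p∪q (vars a) _))
  ... | no a-empty = ∪-least (λ x∈a → ⊥-elim (a-empty (_ , x∈a))) (varsL⊆scopes-nonconstant as)

  nonconstant-separated : ∀ (as : List (SPF n k)) → PairwiseDisjoint as → Separated (nonconstant as)
  nonconstant-separated []       _              = tt
  nonconstant-separated (a ∷ as) (a∩as-empty , as-disjoint) with nonempty? (vars a)
  ... | yes a-nonempty = a-nonempty , eval-supportedIn a ,
                         Disjoint-mono id (scopes-nonconstant as) (Empty∩⇒Disjoint a∩as-empty) ,
                         nonconstant-separated as as-disjoint
  ... | no _           = nonconstant-separated as as-disjoint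

  nonconstant-linear : ∀ (as : List (SPF n 0)) → All (DegLe1 ∘ poly) (nonconstant as)
  nonconstant-linear []       = []
  nonconstant-linear (a ∷ as) with nonempty? (vars a)
  ... | yes _ = eval-DegLe1 a ∷ nonconstant-linear as
  ... | no _  = nonconstant-linear as

  constantPart-constant : ∀ (as : List (SPF n k)) → Constant (constantPart as)
  constantPart-constant []       = SupportedIn-oneP _
  constantPart-constant (a ∷ as) with nonempty? (vars a)
  ... | yes _      = constantPart-constant as
  ... | no a-empty = Constant-⊗ (SupportedIn-mono (λ x∈a → ⊥-elim (a-empty (_ , x∈a))) (eval-supportedIn a))
                                (constantPart-constant as)

  evalL-split : ∀ (as : List (SPF n k)) → evalL as ≐ (constantPart as ⊗ ∏ (nonconstant as))
  evalL-split []       = ≐-sym (⊗-identityˡ oneP)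
  evalL-split (a ∷ as) with nonempty? (vars a)
  ... | yes _ = ≐-trans (⊗-cong (≐-refl {p = eval a}) (evalL-split as))
                        (⊗-Properties.x∙yz≈y∙xz (eval a) (constantPart as) (∏ (nonconstant as)))
  ... | no _  = ≐-trans (⊗-cong (≐-refl {p = eval a}) (evalL-split as))
                        (≐-sym (⊗-assoc (eval a) (constantPart as) (∏ (nonconstant as))))

  ∣varsL∣≤length-nonconstant* : ∀ (as : List (SPF n k)) {C} → All (λ a → ∣ vars a ∣ ≤ C) as →
             ∣ varsL as ∣ ≤ length (nonconstant as) ℕ.* C
  ∣varsL∣≤length-nonconstant* {n} []       _ = ℕₚ.≤-reflexive (∣⊥∣≡0 n)
  ∣varsL∣≤length-nonconstant* (a ∷ as) (a≤C ∷ as≤C) with nonempty? (vars a)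
  ... | yes _      = ℕₚ.≤-trans (∣p∪q∣≤∣p∣+∣q∣ (vars a) (varsL as)) (ℕₚ.+-mono-≤ a≤C (∣varsL∣≤length-nonconstant* as as≤C))
  ... | no a-empty = ℕₚ.≤-trans (∣p∪q∣≤∣p∣+∣q∣ (vars a) (varsL as))
                       (ℕₚ.≤-trans (ℕₚ.≤-reflexive (≡.cong (ℕ._+ ∣ varsL as ∣) (Empty⇒∣p∣≡0 a-empty)))
                                   (∣varsL∣≤length-nonconstant* as as≤C))

  nonconstant-∷ : ∀ (a : SPF n k) as → length (nonconstant (a ∷ as)) ≤ suc (length (nonconstant as))
  nonconstant-∷ a as with nonempty? (vars a)
  ... | yes _ = ℕₚ.≤-refl
  ... | no _  = ℕₚ.n≤1+n _

  nonconstant-∷-mono : ∀ (a : SPF n k) {as bs} → length (nonconstant as) ≤ suc (length (nonconstant bs)) →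
                       length (nonconstant (a ∷ as)) ≤ suc (length (nonconstant (a ∷ bs)))
  nonconstant-∷-mono a as≤ with nonempty? (vars a)
  ... | yes _ = s≤s as≤
  ... | no _  = as≤

  absorb-children : ∀ c (fs : List (Factor n)) (as : List (SPF n k)) →
                    ((c ⊗ ∏ fs) ⊗ evalL as) ≐ ((c ⊗ constantPart as) ⊗ ∏ (fs ++ nonconstant as))
  absorb-children c fs as =
    ≐-trans (⊗-cong (≐-refl {p = c ⊗ ∏ fs}) (evalL-split as))
    (≐-trans (⊗-Properties.interchange c (∏ fs) (constantPart as) (∏ (nonconstant as)))
             (⊗-cong (≐-refl {p = c ⊗ constantPart as}) (≐-sym (∏-++ fs (nonconstant as)))))

  record Largest (as : List (SPF n k)) : Set where
    field
      chosen          : SPF n k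
      others          : List (SPF n k)
      evalL-chosen    : evalL as ≐ (eval chosen ⊗ evalL others)
      chosen⊆         : vars chosen ⊆ varsL as
      others⊆         : varsL others ⊆ varsL as
      chosen#others   : Disjoint (vars chosen) (varsL others)
      others-disjoint : PairwiseDisjoint others
      chosen-synML    : SynML chosen
      chosen-maximal  : All (λ b → ∣ vars b ∣ ≤ ∣ vars chosen ∣) as
      sizes-split     : sizes as ≡ size chosen ℕ.+ sizes others
      others-count    : length (nonconstant as) ≤ suc (length (nonconstant others))

  Largest-head : ∀ (a : SPF n k) bs → PairwiseDisjoint (a ∷ bs) → SynML a →
                 All (λ b → ∣ vars b ∣ ≤ ∣ vars a ∣) bs → Largest (a ∷ bs)
  Largest-head a bs (a∩bs-empty , bs-disjoint) a-synML bs≤a = record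
    { chosen = a ; others = bs ; evalL-chosen = ≐-refl
    ; chosen⊆ = p⊆p∪q (varsL bs) ; others⊆ = q⊆p∪q (vars a) _
    ; chosen#others = Empty∩⇒Disjoint a∩bs-empty ; others-disjoint = bs-disjoint ; chosen-synML = a-synML
    ; chosen-maximal = ℕₚ.≤-refl ∷ bs≤a ; sizes-split = refl ; others-count = nonconstant-∷ a bs }

  Largest-tail : ∀ (a : SPF n k) {bs} → Empty (vars a ∩ varsL bs) → (L : Largest bs) →
                 ∣ vars a ∣ ≤ ∣ vars (Largest.chosen L) ∣ → Largest (a ∷ bs)
  Largest-tail a {bs} a∩bs-empty L a≤c = record
    { chosen = c ; others = a ∷ os
    ; evalL-chosen = ≐-trans (⊗-cong (≐-refl {p = eval a}) evalL-chosen)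
                             (⊗-Properties.x∙yz≈y∙xz (eval a) (eval c) (evalL os))
    ; chosen⊆ = ⊆-trans chosen⊆ (q⊆p∪q (vars a) _)
    ; others⊆ = ∪-least (p⊆p∪q _) (⊆-trans others⊆ (q⊆p∪q (vars a) _))
    ; chosen#others = Disjoint-sym (Disjoint-∪ (Disjoint-mono id chosen⊆ a#bs) (Disjoint-sym chosen#others))
    ; others-disjoint = (λ (x , x∈) → let x∈a , x∈os = x∈p∩q⁻ (vars a) _ x∈ in a#bs x∈a (others⊆ x∈os))
                        , others-disjoint
    ; chosen-synML = chosen-synML
    ; chosen-maximal = a≤c ∷ chosen-maximal
    ; sizes-split = ≡.trans (≡.cong (size a ℕ.+_) sizes-split)
                            (CommutativeSemigroupProperties.x∙yz≈y∙xz ℕₚ.+-commutativeSemigroup (size a) (size c) (sizes os))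
    ; others-count = nonconstant-∷-mono a others-count }
    where
      open Largest L renaming (chosen to c; others to os)
      a#bs : Disjoint (vars a) (varsL bs)
      a#bs = Empty∩⇒Disjoint a∩bs-empty

  largestChild : ∀ (a : SPF n k) as → PairwiseDisjoint (a ∷ as) → SynMLs (a ∷ as) → Largest (a ∷ as)
  largestChild a []       disjoint (a-synML , _) = Largest-head a [] disjoint a-synML []
  largestChild a (b ∷ bs) disjoint@(a∩bs-empty , bs-disjoint) (a-synML , bs-synML)
    with largestChild b bs bs-disjoint bs-synML
  ... | L with ∣ vars (Largest.chosen L) ∣ ℕ.≤? ∣ vars a ∣
  ...   | yes c≤a = Largest-head a (b ∷ bs) disjoint a-synML
                      (All.map (λ b≤c → ℕₚ.≤-trans b≤c c≤a) (Largest.chosen-maximal L))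
  ...   | no  c≰a = Largest-tail a a∩bs-empty L (ℕₚ.<⇒≤ (ℕₚ.≰⇒> c≰a))

module Decompositions (F : Field) (t : ℕ) where
  open Poly F
  open PolynomialSemiring F
  open Support F
  open Factorisation F
  open Data.Nat using (_+_; _*_)

  record Decomposition (s : ℕ) (h : MPoly n) : Set where
    constructor decomposition
    field
      products           : List (MPoly n)
      simples            : List (MPoly n)
      products-isProduct : All (IsProduct t) products
      simples-isSimple   : All (IsSimple t) simples
      count              : length products + length simples ≤ s
      sum≐               : h ≐ (sumL products ⊕ sumL simples)

  Decomposition-cong : ∀ {s} {h h′ : MPoly n} → h ≐ h′ → Decomposition s h′ → Decomposition s h
  Decomposition-cong h≐h′ (decomposition P Q P-ok Q-ok count h′≐) = decomposition P Q P-ok Q-ok count (≐-trans h≐h′ h′≐)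

  Decomposition-mono : ∀ {s s′} {h : MPoly n} → s ≤ s′ → Decomposition s h → Decomposition s′ h
  Decomposition-mono s≤s′ (decomposition P Q P-ok Q-ok count h≐) = decomposition P Q P-ok Q-ok (ℕₚ.≤-trans count s≤s′) h≐

  Decomposition-zeroP : Decomposition {n} 0 zeroP
  Decomposition-zeroP = decomposition [] [] [] [] z≤n (≐-sym (⊕-identityʳ zeroP))

  IsProduct⇒Decomposition : ∀ {h : MPoly n} → IsProduct t h → Decomposition 1 h
  IsProduct⇒Decomposition {h = h} h-product =
    decomposition (h ∷ []) [] (h-product ∷ []) [] ℕₚ.≤-refl
      (≐-sym (≐-trans (⊕-identityʳ (h ⊕ zeroP)) (⊕-identityʳ h)))

  IsSimple⇒Decomposition : ∀ {h : MPoly n} → IsSimple t h → Decomposition 1 h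
  IsSimple⇒Decomposition {h = h} h-simple =
    decomposition [] (h ∷ []) [] (h-simple ∷ []) ℕₚ.≤-refl
      (≐-sym (≐-trans (⊕-identityˡ (h ⊕ zeroP)) (⊕-identityʳ h)))

  sumL-++ : ∀ (ps qs : List (MPoly n)) → sumL (ps ++ qs) ≐ (sumL ps ⊕ sumL qs)
  sumL-++ []       qs = ≐-sym (⊕-identityˡ (sumL qs))
  sumL-++ (p ∷ ps) qs = ≐-trans (⊕-cong (≐-refl {p = p}) (sumL-++ ps qs)) (≐-sym (⊕-assoc p (sumL ps) (sumL qs)))

  Decomposition-⊕ : ∀ {s₁ s₂} {h₁ h₂ : MPoly n} →
                    Decomposition s₁ h₁ → Decomposition s₂ h₂ → Decomposition (s₁ + s₂) (h₁ ⊕ h₂)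
  Decomposition-⊕ (decomposition P₁ Q₁ P₁-ok Q₁-ok count₁ h₁≐) (decomposition P₂ Q₂ P₂-ok Q₂-ok count₂ h₂≐) =
    decomposition (P₁ ++ P₂) (Q₁ ++ Q₂) (All.++⁺ P₁-ok P₂-ok) (All.++⁺ Q₁-ok Q₂-ok)
      (ℕₚ.≤-trans (ℕₚ.≤-reflexive count≡) (ℕₚ.+-mono-≤ count₁ count₂))
      (≐-trans (⊕-cong h₁≐ h₂≐)
        (≐-trans (⊕-Properties.interchange (sumL P₁) (sumL Q₁) (sumL P₂) (sumL Q₂))
                 (≐-sym (⊕-cong (sumL-++ P₁ P₂) (sumL-++ Q₁ Q₂)))))
    where
      count≡ : length (P₁ ++ P₂) + length (Q₁ ++ Q₂) ≡ (length P₁ + length Q₁) + (length P₂ + length Q₂)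
      count≡ = ≡.trans (≡.cong₂ _+_ (List.length-++ P₁) (List.length-++ Q₁))
                       (CommutativeSemigroupProperties.interchange ℕₚ.+-commutativeSemigroup
                         (length P₁) (length P₂) (length Q₁) (length Q₂))

  module _ (1≤t : 1 ≤ t) where

    simple-without-first : ∀ f (gs : List (Factor n)) {X V} → Separated (f ∷ gs) → All (DegLe1 ∘ poly) (f ∷ gs) →
                           SupportedIn V X → Disjoint V (scopes (f ∷ gs)) →
                           400 * t ≤ ∣ scopes gs ∣ → length gs ≤ t → IsSimple t (∏ (f ∷ gs) ⊗ X)
    simple-without-first f gs {X} ((x , x∈f) , f-supp , f#gs , gs-sep) (_ ∷ gs-lin) X-supp V#fgs big len =
      IsSimple-cong (⊗-Properties.xy∙z≈y∙xz (poly f) (∏ gs) X)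
        (factors-isSimple gs gs-sep gs-lin (SupportedIn-⊗ f-supp X-supp)
          (Disjoint-∪ f#gs (Disjoint-mono id (q⊆p∪q (scope f) (scopes gs)) V#fgs))
          (x , x∉p⇒x∈∁p (f#gs x∈f)) big len)

    -- With two factors or more, one of the first two can join G.
    several-linear-isSimple : ∀ f₁ f₂ (fs : List (Factor n)) {X V} → Separated (f₁ ∷ f₂ ∷ fs) →
                              All (DegLe1 ∘ poly) (f₁ ∷ f₂ ∷ fs) → SupportedIn V X → Disjoint V (scopes (f₁ ∷ f₂ ∷ fs)) →
                              801 * t < ∣ scopes (f₁ ∷ f₂ ∷ fs) ∣ → length (f₁ ∷ f₂ ∷ fs) ≤ t →
                              IsSimple t (∏ (f₁ ∷ f₂ ∷ fs) ⊗ X)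
    several-linear-isSimple f₁ f₂ fs {X} sep lin@(lin₁ ∷ lin₂ ∷ fs-lin) X-supp V# big len
      with 400 * t ℕ.≤? ∣ scopes (f₂ ∷ fs) ∣
    ... | yes big₂ = simple-without-first f₁ (f₂ ∷ fs) sep lin X-supp V# big₂ (ℕₚ.≤-trans (ℕₚ.n≤1+n _) len)
    ... | no small₂ = IsSimple-cong (⊗-cong (≐-sym (∏-swap f₁ f₂ fs)) (≐-refl {p = X}))
      (simple-without-first f₂ (f₁ ∷ fs) (Separated-swap sep) (lin₂ ∷ lin₁ ∷ fs-lin) X-supp
        (Disjoint-mono id (scopes-swap f₁ f₂ fs) V#) big₁ (ℕₚ.≤-trans (ℕₚ.n≤1+n _) len))
      where
        open ℕₚ.≤-Reasoning
        big₁ : 400 * t ≤ ∣ scopes (f₁ ∷ fs) ∣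
        big₁ = ℕₚ.<⇒≤ (ℕₚ.+-cancelˡ-< (400 * t) _ _ (begin-strict
          400 * t + 400 * t                        ≡⟨ ℕₚ.*-distribʳ-+ t 400 400 ⟨
          800 * t                                  ≤⟨ ℕₚ.*-monoˡ-≤ t (ℕₚ.n≤1+n 800) ⟩
          801 * t                                  <⟨ big ⟩
          ∣ scopes (f₁ ∷ f₂ ∷ fs) ∣                ≤⟨ p⊆q⇒∣p∣≤∣q∣ (scopes-swap f₂ f₁ fs) ⟩
          ∣ scope f₂ ∪ scopes (f₁ ∷ fs) ∣          ≤⟨ ∣p∪q∣≤∣p∣+∣q∣ (scope f₂) (scopes (f₁ ∷ fs)) ⟩
          ∣ scope f₂ ∣ + ∣ scopes (f₁ ∷ fs) ∣      <⟨ ℕₚ.+-monoˡ-< ∣ scopes (f₁ ∷ fs) ∣ (ℕₚ.≤-<-trans (∣p∣≤∣p∪q∣ (scope f₂) (scopes fs)) (ℕₚ.≰⇒> small₂)) ⟩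
          400 * t + ∣ scopes (f₁ ∷ fs) ∣           ∎))

    ∣∁⁅x⁆∣≥400t : ∀ (x : Fin n) → 801 * t < n → 400 * t ≤ ∣ ∁ ⁅ x ⁆ ∣
    ∣∁⁅x⁆∣≥400t {n} x big = ℕₚ.+-cancelʳ-≤ 1 _ _ (begin
      400 * t + 1      ≤⟨ ℕₚ.+-monoˡ-≤ 1 (ℕₚ.*-monoˡ-≤ t (ℕₚ.m≤m+n 400 401)) ⟩
      801 * t + 1      ≡⟨ ℕₚ.+-comm (801 * t) 1 ⟩
      suc (801 * t)    ≤⟨ big ⟩
      n                ≡⟨ ∣∁⁅x⁆∣+1≡n x ⟨
      ∣ ∁ ⁅ x ⁆ ∣ + 1  ∎)
      where open ℕₚ.≤-Reasoning

    t≤1+∣∁⁅x⁆∣ : ∀ (x : Fin n) → 801 * t < n → t ≤ 1 + ∣ ∁ (⁅ x ⁆ ∪ Subset.⊥) ∣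
    t≤1+∣∁⁅x⁆∣ {n} x big = begin
      t                                              ≤⟨ ℕₚ.≤-trans (ℕₚ.m≤n*m t 801) (ℕₚ.<⇒≤ big) ⟩
      n                                              ≡⟨ ∣∁p∣+∣p∣≡n (⁅ x ⁆ ∪ Subset.⊥) ⟨
      ∣ ∁ (⁅ x ⁆ ∪ Subset.⊥) ∣ + ∣ ⁅ x ⁆ ∪ Subset.⊥ ∣ ≤⟨ ℕₚ.+-monoʳ-≤ _ (ℕₚ.≤-trans (∣p∪q∣≤∣p∣+∣q∣ ⁅ x ⁆ Subset.⊥)
                                                         (ℕₚ.≤-reflexive (≡.cong₂ _+_ (∣⁅x⁆∣≡1 x) (∣⊥∣≡0 n)))) ⟩
      ∣ ∁ (⁅ x ⁆ ∪ Subset.⊥) ∣ + 1                    ≡⟨ ℕₚ.+-comm _ 1 ⟩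
      1 + ∣ ∁ (⁅ x ⁆ ∪ Subset.⊥) ∣                    ∎
      where open ℕₚ.≤-Reasoning

    -- L splits at x into its part avoiding x, t-simple with {x} as the last block,
    -- and its part containing x, which is c · x and so a t-product.
    single-linear-decomposition : ∀ {L X : MPoly n} x → DegLe1 L → Constant X → 801 * t < n →
                                  Decomposition 2 ((L ⊗ oneP) ⊗ X)
    single-linear-decomposition {n} {L} {X} x L-lin X-const big =
      Decomposition-cong split
        (Decomposition-⊕ (IsSimple⇒Decomposition avoiding-isSimple) (IsProduct⇒Decomposition containing-isProduct))
      where
        A = avoiding x L
        C = containing x L

        split : ((L ⊗ oneP) ⊗ X) ≐ ((A ⊗ X) ⊕ (C ⊗ X))
        split = ≐-trans (⊗-cong (≐-trans (⊗-identityʳ L) (avoiding⊕containing x L)) (≐-refl {p = X}))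
                        (⊗-distribʳ X A C)

        x∈∁[∁⁅x⁆] : x ∈ ∁ (∁ ⁅ x ⁆ ∪ Subset.⊥)
        x∈∁[∁⁅x⁆] = x∉p⇒x∈∁p λ x∈ → [ x∈p⇒x∉∁p (x∈⁅x⁆ x) , ∉⊥ ]′ (x∈p∪q⁻ (∁ ⁅ x ⁆) Subset.⊥ x∈)

        avoiding-isSimple : IsSimple t (A ⊗ X)
        avoiding-isSimple = IsSimple-cong (⊗-cong (≐-sym (⊗-identityʳ A)) (≐-refl {p = X}))
          (factors-isSimple (factor A (∁ ⁅ x ⁆) ∷ [])
            (∣p∣≥1⇒Nonempty _ (ℕₚ.≤-trans (ℕₚ.≤-trans 1≤t (ℕₚ.m≤n*m t 400)) (∣∁⁅x⁆∣≥400t x big)) ,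
              avoiding-supportedIn x L , (λ _ → ∉⊥) , tt)
            (avoiding-DegLe1 x L-lin ∷ []) X-const (λ x∈⊥ _ → ∉⊥ x∈⊥) (x , x∈∁[∁⁅x⁆])
            (ℕₚ.≤-trans (∣∁⁅x⁆∣≥400t x big) (∣p∣≤∣p∪q∣ (∁ ⁅ x ⁆) Subset.⊥)) 1≤t)

        containing-isProduct : IsProduct t (C ⊗ X)
        containing-isProduct =
          IsProduct-cong (≐-trans (⊗-comm C X) (⊗-cong (≐-refl {p = X}) (≐-sym (⊗-identityʳ C))))
            (product-isProduct (factor C ⁅ x ⁆ ∷ [])
              ((x , x∈⁅x⁆ x) , containing-supportedIn x L-lin , (λ _ → ∉⊥) , tt) X-const 1≤t (t≤1+∣∁⁅x⁆∣ x big))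

    linear-decomposition : ∀ (Ls : List (Factor n)) {X V} → Separated Ls → All (DegLe1 ∘ poly) Ls →
                           SupportedIn V X → Disjoint V (scopes Ls) → 801 * t < ∣ scopes Ls ∣ → length Ls ≤ t →
                           Decomposition 2 (∏ Ls ⊗ X)
    linear-decomposition {n} [] _ _ _ _ big _ = ⊥-elim (ℕₚ.n≮0 (≡.subst (801 * t <_) (∣⊥∣≡0 n) big))
    linear-decomposition (f₁ ∷ f₂ ∷ fs) sep lin X-supp V# big len = Decomposition-mono (s≤s z≤n)
      (IsSimple⇒Decomposition (several-linear-isSimple f₁ f₂ fs sep lin X-supp V# big len))
    linear-decomposition (f ∷ []) {X} sep lin X-supp V# big len with nonempty? (∁ (scopes (f ∷ [])))
    ... | yes uncovered = Decomposition-mono (s≤s z≤n) (IsSimple⇒Decomposition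
      (factors-isSimple (f ∷ []) sep lin X-supp V# uncovered
        (ℕₚ.≤-trans (ℕₚ.*-monoˡ-≤ t (ℕₚ.m≤m+n 400 401)) (ℕₚ.<⇒≤ big)) len))
    ... | no covered = single-linear-decomposition (proj₁ (proj₁ sep)) (All.head lin) X-const
                            (ℕₚ.<-≤-trans big (∣p∣≤n (scopes (f ∷ []))))
      where
        ∈scopes : ∀ y → y ∈ scopes (f ∷ [])
        ∈scopes y with y ∈? scopes (f ∷ [])
        ... | yes y∈ = y∈
        ... | no y∉  = ⊥-elim (covered (y , x∉p⇒x∈∁p y∉))

        X-const : Constant X
        X-const = SupportedIn-mono (λ {y} y∈V → ⊥-elim (V# y∈V (∈scopes y))) X-supp

-- The descent through the formula

-- ks lists, for each product layer passed so far, one more than the number of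
-- nonconstant siblings set aside there; as those siblings become blocks, only
-- histories with sum (map pred ks) < t are ever reached.
Feasible : ℕ → ℕ → ℕ → Set
Feasible n t L = ∀ ks → length ks ≤ L → All (1 ≤_) ks → sum (map pred ks) < t →
                 product ks ℕ.* ((801 ℕ.+ L) ℕ.* t) ℕ.+ t ≤ n

module DescentArithmetic where
  open Data.Nat using (_+_; _*_)
  open ℕₚ.≤-Reasoning

  bound-at-bottom : ∀ {n t L} P V m → P * ((801 + L) * t) + t ≤ n → n < P * (V + m * t) + t → m ≤ L →
                    801 * t < V
  bound-at-bottom {n} {t} {L} P V m budget n< m≤L = ℕₚ.+-cancelʳ-< (m * t) (801 * t) V (begin-strict
    801 * t + m * t  ≤⟨ ℕₚ.+-monoʳ-≤ (801 * t) (ℕₚ.*-monoˡ-≤ t m≤L) ⟩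
    801 * t + L * t  ≡⟨ ℕₚ.*-distribʳ-+ t 801 L ⟨
    (801 + L) * t    <⟨ ℕₚ.*-cancelˡ-< P _ _ (ℕₚ.+-cancelʳ-< t _ _ (ℕₚ.≤-<-trans budget n<)) ⟩
    V + m * t        ∎)

  bound-step : ∀ {n t} P V m k C V′ → n < P * (V + m * t) + t → 1 ≤ k → V ≤ k * C → C ≤ V′ + t →
               n < (k * P) * (V′ + (t + m * t)) + t
  bound-step {n} {t} P V m k C V′ n< 1≤k V≤kC C≤V′+t = ℕₚ.<-≤-trans n< (ℕₚ.+-monoˡ-≤ t (begin
    P * (V + m * t)                 ≤⟨ ℕₚ.*-monoʳ-≤ P (ℕₚ.+-mono-≤ V≤kC (ℕₚ.m≤n*m (m * t) k {{ℕ.>-nonZero 1≤k}})) ⟩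
    P * (k * C + k * (m * t))       ≤⟨ ℕₚ.*-monoʳ-≤ P (ℕₚ.+-monoˡ-≤ (k * (m * t)) (ℕₚ.*-monoʳ-≤ k C≤V′+t)) ⟩
    P * (k * (V′ + t) + k * (m * t)) ≡⟨ rearrange P k V′ t m ⟩
    (k * P) * (V′ + (t + m * t))    ∎))
    where
      open +-*-Solver
      rearrange : ∀ P k V′ t m → P * (k * (V′ + t) + k * (m * t)) ≡ (k * P) * (V′ + (t + m * t))
      rearrange = solve 5 (λ P k V′ t m → P :* (k :* (V′ :+ t) :+ k :* (m :* t)) := (k :* P) :* (V′ :+ (t :+ m :* t))) refl

module Descent (F : Field) (n t L : ℕ) (1≤t : 1 ≤ t) (feasible : Feasible n t L) where
  open Poly F
  open PolynomialSemiring F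
  open Support F
  open Factorisation F
  open Children F
  open Decompositions F t
  open DescentArithmetic
  open Data.Nat using (_+_; _*_)

  private
    variable
      k : ℕ

  -- Any V variables leaving, together with the scopes of fs, fewer than t
  -- variables uncovered satisfy this bound; at the bottom it forces more than
  -- 801 t variables into the linear forms.
  CoverBound : List (Factor n) → List ℕ → Set
  CoverBound fs ks = ∀ V → n < ∣ scopes fs ∣ + V + t → n < product ks * (V + length ks * t) + t

  -- The summand being expanded is prefix ⊗ (the gate below), with k product
  -- layers left in that gate and V its variables.
  record State (k : ℕ) (V : Subset n) : Set where
    field
      coeff             : MPoly n
      factors           : List (Factor n)
      history           : List ℕ
      coeff-constant    : Constant coeff
      factors-separated : Separated factors
      factors#V         : Disjoint (scopes factors) V
      history-positive  : All (1 ≤_) history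
      history-length    : length history + k ≤ L
      history-sum       : sum (map pred history) ≤ length factors
      cover-bound       : CoverBound factors history

    prefix : MPoly n
    prefix = coeff ⊗ ∏ factors

    -- The number of blocks obtained by stopping at a gate with children as.
    available : List (SPF n k) → ℕ
    available as = length factors + length (nonconstant as) + ∣ ∁ (scopes factors ∪ varsL as) ∣

  restrict : ∀ {V V′} → V′ ⊆ V → State k V → State k V′
  restrict V′⊆V S = record
    { coeff = coeff ; factors = factors ; history = history
    ; coeff-constant = coeff-constant ; factors-separated = factors-separated
    ; factors#V = Disjoint-mono id V′⊆V factors#V
    ; history-positive = history-positive ; history-length = history-length
    ; history-sum = history-sum ; cover-bound = cover-bound
    }
    where open State S

  initial : ∀ {V} → State L V
  initial = record
    { coeff = oneP ; factors = [] ; history = []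
    ; coeff-constant = SupportedIn-oneP _ ; factors-separated = tt ; factors#V = λ x∈⊥ _ → ∉⊥ x∈⊥
    ; history-positive = [] ; history-length = ℕₚ.≤-refl ; history-sum = z≤n
    ; cover-bound = λ V n< → ≡.subst (λ m → n < m + t)
        (≡.trans (≡.cong (_+ V) (∣⊥∣≡0 n)) (≡.sym (≡.trans (ℕₚ.*-identityˡ _) (ℕₚ.+-identityʳ V)))) n<
    }

  module _ {V} (S : State k V) (as : List (SPF n k)) where
    open State S

    few⇒count< : available as < t → length factors + length (nonconstant as) < t
    few⇒count< few = ℕₚ.≤-<-trans (ℕₚ.m≤m+n _ (∣ ∁ (scopes factors ∪ varsL as) ∣)) few

    few⇒almost-covered : available as < t → n < ∣ scopes factors ∣ + ∣ varsL as ∣ + t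
    few⇒almost-covered few = begin-strict
      n                         ≡⟨ ≡.trans (ℕₚ.+-comm ∣ U ∣ ∣ ∁ U ∣) (∣∁p∣+∣p∣≡n U) ⟨
      ∣ U ∣ + ∣ ∁ U ∣            <⟨ ℕₚ.+-monoʳ-< ∣ U ∣ (ℕₚ.≤-<-trans (ℕₚ.m≤n+m _ _) few) ⟩
      ∣ U ∣ + t                  ≤⟨ ℕₚ.+-monoˡ-≤ t (∣p∪q∣≤∣p∣+∣q∣ (scopes factors) (varsL as)) ⟩
      ∣ scopes factors ∣ + ∣ varsL as ∣ + t ∎
      where
        open ℕₚ.≤-Reasoning
        U = scopes factors ∪ varsL as

  decomposeAsProduct : ∀ {as : List (SPF n k)} → PairwiseDisjoint as → (S : State k (varsL as)) → t ≤ State.available S as →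
         Decomposition 1 (State.prefix S ⊗ evalL as)
  decomposeAsProduct {as = as} as-disjoint S enough = IsProduct⇒Decomposition (IsProduct-cong (absorb-children coeff factors as)
    (product-isProduct (factors ++ nonconstant as) separated
      (Constant-⊗ coeff-constant (constantPart-constant as)) 1≤t t≤))
    where
      open State S
      open ℕₚ.≤-Reasoning

      separated : Separated (factors ++ nonconstant as)
      separated = Separated-++ factors-separated (nonconstant-separated as as-disjoint)
                               (Disjoint-mono id (scopes-nonconstant as) factors#V)

      t≤ : t ≤ length (factors ++ nonconstant as) + ∣ ∁ (scopes (factors ++ nonconstant as)) ∣
      t≤ = begin
        t                                                                   ≤⟨ enough ⟩
        length factors + length (nonconstant as) + ∣ ∁ (scopes factors ∪ varsL as) ∣
          ≤⟨ ℕₚ.+-mono-≤ (ℕₚ.≤-reflexive (≡.sym (List.length-++ factors)))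
               (p⊆q⇒∣p∣≤∣q∣ (p⊆q⇒∁p⊇∁q (⊆-trans (scopes-++ factors (nonconstant as))
                 (∪-least (p⊆p∪q _) (⊆-trans (scopes-nonconstant as) (q⊆p∪q (scopes factors) _)))))) ⟩
        length (factors ++ nonconstant as) + ∣ ∁ (scopes (factors ++ nonconstant as)) ∣ ∎

  decomposeAtBottom : ∀ {as : List (SPF n 0)} → PairwiseDisjoint as → (S : State 0 (varsL as)) → State.available S as < t →
           Decomposition 2 (State.prefix S ⊗ evalL as)
  decomposeAtBottom {as = as} as-disjoint S few = Decomposition-cong rearrange
    (linear-decomposition 1≤t (nonconstant as) (nonconstant-separated as as-disjoint) (nonconstant-linear as)
      X-supp (Disjoint-mono id (scopes-nonconstant as) factors#V) big
      (ℕₚ.<⇒≤ (ℕₚ.≤-<-trans (ℕₚ.m≤n+m _ _) (few⇒count< S as few))))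
    where
      open State S
      X = prefix ⊗ constantPart as

      X-supp : SupportedIn (scopes factors) X
      X-supp = SupportedIn-mono (∪-least (∪-least ⊥⊆ id) ⊥⊆)
        (SupportedIn-⊗ (SupportedIn-⊗ coeff-constant (∏-supportedIn factors-separated)) (constantPart-constant as))

      rearrange : (prefix ⊗ evalL as) ≐ (∏ (nonconstant as) ⊗ X)
      rearrange = ≐-trans (⊗-cong (≐-refl {p = prefix}) (evalL-split as))
        (≐-trans (≐-sym (⊗-assoc prefix (constantPart as) (∏ (nonconstant as)))) (⊗-comm X (∏ (nonconstant as))))

      history≤L : length history ≤ L
      history≤L = ≡.subst (_≤ L) (ℕₚ.+-identityʳ _) history-length

      big : 801 * t < ∣ scopes (nonconstant as) ∣
      big = ℕₚ.<-≤-trans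
        (bound-at-bottom {L = L} (product history) (∣ varsL as ∣) (length history)
          (feasible history history≤L history-positive
            (ℕₚ.≤-<-trans history-sum (ℕₚ.≤-<-trans (ℕₚ.m≤m+n _ _) (few⇒count< S as few))))
          (cover-bound _ (few⇒almost-covered S as few)) history≤L)
        (p⊆q⇒∣p∣≤∣q∣ (varsL⊆scopes-nonconstant as))

  descend : ∀ {as : List (SPF n (suc k))} (S : State (suc k) (varsL as)) (Lg : Largest as) →
            State.available S as < t → State k (vars (Largest.chosen Lg))
  descend {k} {as} S Lg few = record
    { coeff             = coeff ⊗ constantPart others
    ; factors           = factors ++ nonconstant others
    ; history           = suc (length (nonconstant others)) ∷ history
    ; coeff-constant    = Constant-⊗ coeff-constant (constantPart-constant others)
    ; factors-separated = Separated-++ factors-separated (nonconstant-separated others others-disjoint)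
                            (Disjoint-mono id (⊆-trans (scopes-nonconstant others) others⊆) factors#V)
    ; factors#V         = factors′#chosen
    ; history-positive  = s≤s z≤n ∷ history-positive
    ; history-length    = ≡.subst (_≤ L) (ℕₚ.+-suc (length history) k) history-length
    ; history-sum       = ℕₚ.≤-trans (ℕₚ.+-monoʳ-≤ (length (nonconstant others)) history-sum)
                            (ℕₚ.≤-reflexive (≡.trans (ℕₚ.+-comm (length (nonconstant others)) (length factors))
                                                   (≡.sym (List.length-++ factors))))
    ; cover-bound       = λ V′ n< →
        bound-step (product history) (∣ varsL as ∣) (length history) (suc (length (nonconstant others)))
          (∣ vars chosen ∣) V′ (cover-bound _ (few⇒almost-covered S as few)) (s≤s z≤n) varsL≤ (chosen≤ V′ n<)
    }
    where
      open State S
      open Largest Lg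

      factors′#chosen : Disjoint (scopes (factors ++ nonconstant others)) (vars chosen)
      factors′#chosen = Disjoint-mono (scopes-++ factors (nonconstant others)) id
        (Disjoint-∪ (Disjoint-mono id chosen⊆ factors#V)
                    (Disjoint-mono (scopes-nonconstant others) id (Disjoint-sym chosen#others)))

      varsL≤ : ∣ varsL as ∣ ≤ suc (length (nonconstant others)) * ∣ vars chosen ∣
      varsL≤ = ℕₚ.≤-trans (∣varsL∣≤length-nonconstant* as chosen-maximal) (ℕₚ.*-monoˡ-≤ ∣ vars chosen ∣ others-count)

      chosen≤ : ∀ V′ → n < ∣ scopes (factors ++ nonconstant others) ∣ + V′ + t → ∣ vars chosen ∣ ≤ V′ + t
      chosen≤ V′ n< = ℕₚ.<⇒≤ (ℕₚ.+-cancelˡ-< ∣ scopes (factors ++ nonconstant others) ∣ _ _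
        (ℕₚ.≤-<-trans (Disjoint⇒∣p∣+∣q∣≤n factors′#chosen) (≡.subst (n <_) (ℕₚ.+-assoc _ V′ t) n<)))

  descend-prefix : ∀ {as : List (SPF n (suc k))} (S : State (suc k) (varsL as)) (Lg : Largest as)
                   (few : State.available S as < t) →
                   (State.prefix S ⊗ evalL as) ≐ (State.prefix (descend S Lg few) ⊗ eval (Largest.chosen Lg))
  descend-prefix S Lg few =
    ≐-trans (⊗-cong (≐-refl {p = prefix}) evalL-chosen)
    (≐-trans (⊗-Properties.x∙yz≈xz∙y prefix (eval chosen) (evalL others))
             (⊗-cong (absorb-children coeff factors others) (≐-refl {p = eval chosen})))
    where
      open State S
      open Largest Lg

  size≥1 : ∀ (a : SPF n k) → 1 ≤ size a
  size≥1 (bottom _ _) = s≤s z≤n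
  size≥1 (top _ _)    = s≤s z≤n

  mutual
    decomposeGate : ∀ k (q : PG n k) → SynMLPG q → (S : State k (varsPG q)) →
                    Decomposition (sizePG q) (State.prefix S ⊗ evalPG q)
    decomposeGate k (prod a as) (pd , a-synML , as-synML) S with t ℕ.≤? State.available S (a ∷ as)
    ... | yes enough = Decomposition-mono (s≤s z≤n) (decomposeAsProduct {as = a ∷ as} pd S enough)
    ... | no  few    = decomposeBelow k a as pd (a-synML , as-synML) S (ℕₚ.≰⇒> few)

    decomposeBelow : ∀ k (a : SPF n k) as → PairwiseDisjoint (a ∷ as) → SynMLs (a ∷ as) →
                     (S : State k (varsL (a ∷ as))) → State.available S (a ∷ as) < t →
                     Decomposition (suc (sizes (a ∷ as))) (State.prefix S ⊗ evalL (a ∷ as))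
    decomposeBelow zero    a as pd _     S few =
      Decomposition-mono (s≤s (ℕₚ.≤-trans (size≥1 a) (ℕₚ.m≤m+n _ (sizes as)))) (decomposeAtBottom {as = a ∷ as} pd S few)
    decomposeBelow (suc k) a as pd synML S few =
      Decomposition-mono (ℕₚ.m≤n⇒m≤1+n (ℕₚ.≤-trans (ℕₚ.m≤m+n _ _) (ℕₚ.≤-reflexive (≡.sym sizes-split))))
        (Decomposition-cong (descend-prefix S Lg few) (decomposeSum k chosen chosen-synML (descend S Lg few)))
      where
        Lg = largestChild a as pd synML
        open Largest Lg

    decomposeSum : ∀ k (c : SPF n (suc k)) → SynML c → (S : State k (vars c)) →
                   Decomposition (size c) (State.prefix S ⊗ eval c)
    decomposeSum k (top q qs) synML S = Decomposition-mono (ℕₚ.n≤1+n _) (decomposeGates k (q ∷ qs) synML S)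

    decomposeGates : ∀ k (qs : List (PG n k)) → SynMLPGs qs → (S : State k (varsPGs qs)) →
                     Decomposition (sizePGs qs) (State.prefix S ⊗ evalPGs qs)
    decomposeGates k []       _                     S = Decomposition-cong (⊗-zeroʳ (State.prefix S)) Decomposition-zeroP
    decomposeGates k (q ∷ qs) (q-synML , qs-synML) S =
      Decomposition-cong (⊗-distribˡ (State.prefix S) (evalPG q) (evalPGs qs))
        (Decomposition-⊕ (decomposeGate k q q-synML (restrict (p⊆p∪q (varsPGs qs)) S))
                         (decomposeGates k qs qs-synML (restrict (q⊆p∪q (varsPG q) (varsPGs qs)) S)))

  decompose : (Φ : SPF n (suc L)) → SynML Φ → Decomposition (size Φ) (eval Φ)
  decompose Φ synML = Decomposition-cong
    (≐-sym (≐-trans (⊗-cong (⊗-identityˡ oneP) (≐-refl {p = eval Φ})) (⊗-identityˡ (eval Φ))))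
    (decomposeSum L Φ synML initial)

-- Arithmetic for the choice of t

module NatLemmas where
  open Data.Nat using (_+_; _*_; _^_; _∸_)
  open +-*-Solver using (solve; _:+_; _:*_; _:=_; con)
  open ℕₚ.≤-Reasoning
  open CommutativeSemigroupProperties ℕₚ.*-commutativeSemigroup public
    using () renaming (interchange to *-interchange; x∙yz≈y∙xz to x*[y*z]≡y*[x*z])

  ^-distribʳ-* : ∀ x y k → (x * y) ^ k ≡ x ^ k * y ^ k
  ^-distribʳ-* x y zero    = refl
  ^-distribʳ-* x y (suc k) =
    ≡.trans (≡.cong ((x * y) *_) (^-distribʳ-* x y k)) (*-interchange x y (x ^ k) (y ^ k))

  1≤^ : ∀ {x} k → 1 ≤ x → 1 ≤ x ^ k
  1≤^ zero    _   = s≤s z≤n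
  1≤^ (suc k) 1≤x = ℕₚ.*-mono-≤ 1≤x (1≤^ k 1≤x)

  n≤n^[1+k] : ∀ x k → 1 ≤ x → x ≤ x ^ suc k
  n≤n^[1+k] x k 1≤x = ℕₚ.≤-trans (ℕₚ.≤-reflexive (≡.sym (ℕₚ.*-identityʳ x))) (ℕₚ.*-monoʳ-≤ x (1≤^ k 1≤x))

  n<2^n : ∀ k → k < 2 ^ k
  n<2^n zero    = s≤s z≤n
  n<2^n (suc k) = begin-strict
    suc k            ≤⟨ n<2^n k ⟩
    2 ^ k            <⟨ ℕₚ.m<m+n (2 ^ k) (1≤^ {2} k (s≤s z≤n)) ⟩
    2 ^ k + 2 ^ k    ≡⟨ ≡.cong (2 ^ k +_) (ℕₚ.+-identityʳ (2 ^ k)) ⟨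
    2 ^ suc k        ∎

  quotient : ∀ x k → 1 ≤ k → ∃ λ q → k * q ≤ x × x < k * suc q
  quotient x k 1≤k = x / k , k*q≤x , x<k*[1+q]
    where
      instance _ = ℕ.>-nonZero 1≤k
      x≡ : x ≡ x % k + x / k * k
      x≡ = m≡m%n+[m/n]*n x k
      k*q≤x : k * (x / k) ≤ x
      k*q≤x = begin
        k * (x / k)          ≡⟨ ℕₚ.*-comm k (x / k) ⟩
        x / k * k            ≤⟨ ℕₚ.m≤n+m _ (x % k) ⟩
        x % k + x / k * k    ≡⟨ x≡ ⟨
        x                    ∎
      x<k*[1+q] : x < k * suc (x / k)
      x<k*[1+q] = begin-strict
        x                    ≡⟨ x≡ ⟩
        x % k + x / k * k    <⟨ ℕₚ.+-monoˡ-< _ (m%n<n x k) ⟩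
        k + x / k * k        ≡⟨ ≡.cong (k +_) (ℕₚ.*-comm (x / k) k) ⟩
        k + k * (x / k)      ≡⟨ ℕₚ.*-suc k (x / k) ⟨
        k * suc (x / k)      ∎

  -- q = ⌊(k - 1) / a⌋
  k≤a*2^q : ∀ a k → 1 ≤ a → 1 ≤ k → ∃ λ q → a * q ≤ pred k × k ≤ a * 2 ^ q
  k≤a*2^q a (suc k) 1≤a _ with quotient k a 1≤a
  ... | q , a*q≤k , k<a*[1+q] = q , a*q≤k , ℕₚ.≤-trans k<a*[1+q] (ℕₚ.*-monoʳ-≤ a (n<2^n q))

  product≤a^length*2^Q : ∀ a → 1 ≤ a → ∀ ks → All (1 ≤_) ks →
                         ∃ λ Q → a * Q ≤ sum (map pred ks) × product ks ≤ a ^ length ks * 2 ^ Q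
  product≤a^length*2^Q a 1≤a []       []          = 0 , ℕₚ.≤-reflexive (ℕₚ.*-zeroʳ a) , s≤s z≤n
  product≤a^length*2^Q a 1≤a (k ∷ ks) (1≤k ∷ 1≤ks)
    with k≤a*2^q a k 1≤a 1≤k | product≤a^length*2^Q a 1≤a ks 1≤ks
  ... | q , a*q≤ , k≤ | Q , a*Q≤ , ks≤ =
    q + Q ,
    ℕₚ.≤-trans (ℕₚ.≤-reflexive (ℕₚ.*-distribˡ-+ a q Q)) (ℕₚ.+-mono-≤ a*q≤ a*Q≤) ,
    (begin
      k * product ks                                 ≤⟨ ℕₚ.*-mono-≤ k≤ ks≤ ⟩
      (a * 2 ^ q) * (a ^ length ks * 2 ^ Q)          ≡⟨ *-interchange a (2 ^ q) (a ^ length ks) (2 ^ Q) ⟩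
      (a * a ^ length ks) * (2 ^ q * 2 ^ Q)          ≡⟨ ≡.cong (a * a ^ length ks *_) (ℕₚ.^-distribˡ-+-* 2 q Q) ⟨
      a ^ length (k ∷ ks) * 2 ^ (q + Q)              ∎)

  product≤2^sum : ∀ ks → All (1 ≤_) ks → product ks ≤ 2 ^ sum (map pred ks)
  product≤2^sum []           []         = s≤s z≤n
  product≤2^sum (suc k ∷ ks) (_ ∷ 1≤ks) = begin
    suc k * product ks                  ≤⟨ ℕₚ.*-mono-≤ (n<2^n k) (product≤2^sum ks 1≤ks) ⟩
    2 ^ k * 2 ^ sum (map pred ks)       ≡⟨ ℕₚ.^-distribˡ-+-* 2 k _ ⟨
    2 ^ (k + sum (map pred ks))         ∎

  product≥1 : ∀ ks → All (1 ≤_) ks → 1 ≤ product ks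
  product≥1 []       []           = s≤s z≤n
  product≥1 (k ∷ ks) (1≤k ∷ 1≤ks) = ℕₚ.*-mono-≤ 1≤k (product≥1 ks 1≤ks)

  crossing : ∀ (P : ℕ → Set) → Decidable P → ¬ P 0 → ∀ b → P b → ∃ λ t → ¬ P t × P (suc t)
  crossing P P? ¬P0 zero    P0 = ⊥-elim (¬P0 P0)
  crossing P P? ¬P0 (suc b) Pb with P? b
  ... | yes Pb′ = crossing P P? ¬P0 b Pb′
  ... | no ¬Pb′ = b , ¬Pb′ , Pb

  [801+k]k≤1024*4^k : ∀ k → (801 + k) * k ≤ 1024 * 4 ^ k
  [801+k]k≤1024*4^k k = begin
    (801 + k) * k                ≤⟨ ℕₚ.*-mono-≤ 801+k≤ (ℕₚ.<⇒≤ (n<2^n k)) ⟩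
    (1024 * 2 ^ k) * 2 ^ k       ≡⟨ ℕₚ.*-assoc 1024 (2 ^ k) (2 ^ k) ⟩
    1024 * (2 ^ k * 2 ^ k)       ≡⟨ ≡.cong (1024 *_) (^-distribʳ-* 2 2 k) ⟨
    1024 * 4 ^ k                 ∎
    where
      801+k≤ : 801 + k ≤ 1024 * 2 ^ k
      801+k≤ = begin
        801 + k                  ≤⟨ ℕₚ.+-mono-≤ (ℕₚ.*-monoʳ-≤ 801 (1≤^ {2} k (s≤s z≤n))) (ℕₚ.<⇒≤ (n<2^n k)) ⟩
        801 * 2 ^ k + 2 ^ k      ≡⟨ ℕₚ.+-comm (801 * 2 ^ k) (2 ^ k) ⟩
        802 * 2 ^ k              ≤⟨ ℕₚ.*-monoˡ-≤ (2 ^ k) (ℕₚ.≤ᵇ⇒≤ 802 1024 tt) ⟩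
        1024 * 2 ^ k             ∎

  [801+2u]2u≤4*2^u : ∀ u → 20 ≤ u → (801 + 2 * u) * (2 * u) ≤ 4 * 2 ^ u
  [801+2u]2u≤4*2^u u 20≤u =
    ≡.subst (λ u → g 801 u ≤ 4 * 2 ^ u) (ℕₚ.m∸n+n≡m 20≤u) (from20 799 (ℕₚ.≤ᵇ⇒≤ (g 801 20) (4 * 2 ^ 20) tt) (u ∸ 20))
    where
      -- The constant and the offset 20 are kept out of the way of the normaliser,
      -- which would otherwise unfold them into long chains of successors.
      g : ℕ → ℕ → ℕ
      g c u = (c + 2 * u) * (2 * u)

      doubling : ∀ c v → g (2 + c) (3 + v) + (2 * c * (1 + v) + 4 * v * v + 12 * v) ≡ 2 * g (2 + c) (2 + v)
      doubling = solve 2 (λ c v →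
        (con 2 :+ c :+ con 2 :* (con 3 :+ v)) :* (con 2 :* (con 3 :+ v)) :+ (con 2 :* c :* (con 1 :+ v) :+ con 4 :* v :* v :+ con 12 :* v)
        := con 2 :* ((con 2 :+ c :+ con 2 :* (con 2 :+ v)) :* (con 2 :* (con 2 :+ v)))) refl

      from20 : ∀ c → g (2 + c) 20 ≤ 4 * 2 ^ 20 → ∀ w → g (2 + c) (w + 20) ≤ 4 * 2 ^ (w + 20)
      from20 c base zero    = base
      from20 c base (suc w) = begin
        g (2 + c) (suc w + 20)             ≡⟨ ≡.cong (g (2 + c)) (shift w) ⟩
        g (2 + c) (3 + (w + 18))           ≤⟨ ℕₚ.m≤m+n (g (2 + c) (3 + (w + 18))) _ ⟩
        g (2 + c) (3 + (w + 18)) + _       ≡⟨ doubling c (w + 18) ⟩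
        2 * g (2 + c) (2 + (w + 18))       ≡⟨ ≡.cong (λ u → 2 * g (2 + c) u) (unshift w) ⟩
        2 * g (2 + c) (w + 20)             ≤⟨ ℕₚ.*-monoʳ-≤ 2 (from20 c base w) ⟩
        2 * (4 * 2 ^ (w + 20))             ≡⟨ x*[y*z]≡y*[x*z] 2 4 (2 ^ (w + 20)) ⟩
        4 * 2 ^ (suc w + 20)               ∎
        where
          shift : ∀ w → suc w + 20 ≡ 3 + (w + 18)
          shift = solve 1 (λ w → (con 1 :+ w) :+ con 20 := con 3 :+ (w :+ con 18)) refl
          unshift : ∀ w → 2 + (w + 18) ≡ w + 20
          unshift = solve 1 (λ w → con 2 :+ (w :+ con 18) := w :+ con 20) refl

  D[1+q]≤4t : ∀ {D q t} → D ≤ 3 * t → D * q ≤ t → D * suc q ≤ 4 * t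
  D[1+q]≤4t {D} {q} {t} D≤3t Dq≤t = begin
    D * suc q     ≡⟨ ℕₚ.*-suc D q ⟩
    D + D * q     ≤⟨ ℕₚ.+-mono-≤ D≤3t Dq≤t ⟩
    3 * t + t     ≡⟨ ℕₚ.+-comm (3 * t) t ⟩
    4 * t         ∎

-- t is taken least with Δ ^ Δ * d ≤ (m * t) ^ Δ. The bound of Feasible on
-- product ks then follows from 2 ^ Δ ≤ d when t is small compared with Δ, and
-- otherwise from product ks ≤ a ^ L * 2 ^ L with a ≈ t / Δ and the minimality of t.
module Parameters (m : ℕ) (2^16≤m : 2 ℕ.^ 16 ≤ m) where
  open Data.Nat using (_+_; _*_; _^_; _∸_)
  open +-*-Solver using (solve; _:+_; _:*_; _:=_; con)
  open ℕₚ.≤-Reasoning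
  open NatLemmas

  1≤m : 1 ≤ m
  1≤m = ℕₚ.≤-trans (1≤^ {2} 16 (s≤s z≤n)) 2^16≤m

  m≢0 : NonZero m
  m≢0 = ℕ.>-nonZero 1≤m

  d₀ : ℕ
  d₀ = suc (m ^ 40)

  2^L*[801+D]D*4^D≤4m^D : ∀ L → let D = suc L in 2 ^ L * ((801 + D) * D) * 4 ^ D ≤ 4 * m ^ D
  2^L*[801+D]D*4^D≤4m^D L = begin
    2 ^ L * ((801 + D) * D) * 4 ^ D         ≤⟨ ℕₚ.*-monoˡ-≤ (4 ^ D) (ℕₚ.*-mono-≤ (ℕₚ.^-monoʳ-≤ 2 (ℕₚ.n≤1+n L))
                                                                         ([801+k]k≤1024*4^k D)) ⟩
    2 ^ D * (1024 * 4 ^ D) * 4 ^ D          ≡⟨ rearrange (2 ^ D) (4 ^ D) ⟩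
    4 * (256 * ((2 ^ D * 4 ^ D) * 4 ^ D))   ≡⟨ ≡.cong (λ x → 4 * (256 * (x * 4 ^ D))) (^-distribʳ-* 2 4 D) ⟨
    4 * (256 * (8 ^ D * 4 ^ D))             ≡⟨ ≡.cong (λ x → 4 * (256 * x)) (^-distribʳ-* 8 4 D) ⟨
    4 * (256 * 32 ^ D)                      ≤⟨ ℕₚ.*-monoʳ-≤ 4 (ℕₚ.*-monoˡ-≤ (32 ^ D)
                                                  (ℕₚ.≤-trans (ℕₚ.≤ᵇ⇒≤ 256 2048 tt) (ℕₚ.^-monoʳ-≤ 2048 {1} {D} (s≤s z≤n)))) ⟩
    4 * (2048 ^ D * 32 ^ D)                 ≡⟨ ≡.cong (4 *_) (^-distribʳ-* 2048 32 D) ⟨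
    4 * (2048 * 32) ^ D                     ≤⟨ ℕₚ.*-monoʳ-≤ 4 (ℕₚ.^-monoˡ-≤ D 2048*32≤m) ⟩
    4 * m ^ D                               ∎
    where
      D = suc L
      -- 2048 * 32 rather than 2 ^ 16, so that this step and the previous one
      -- meet syntactically instead of through the normaliser.
      2048*32≤m : 2048 * 32 ≤ m
      2048*32≤m = 2^16≤m
      rearrange : ∀ x y → x * (1024 * y) * y ≡ 4 * (256 * ((x * y) * y))
      rearrange = solve 2 (λ x y → x :* (con 1024 :* y) :* y := con 4 :* (con 256 :* ((x :* y) :* y))) refl

  module _ {d L t′ : ℕ} where
    private
      D = suc L
      t = suc t′

    t≤D : 3 * t′ < D → t ≤ D
    t≤D 3t′<D = ℕₚ.≤-trans (s≤s (ℕₚ.m≤n*m t′ 3)) 3t′<D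

    -- Small t forces d ≤ m ^ D, so D is large because d > m ^ 40.
    40≤D : 3 * t′ < D → d₀ ≤ d → D ^ D * d ≤ (m * t) ^ D → 40 ≤ D
    40≤D 3t′<D d₀≤d upper = ℕₚ.≮⇒≥ λ D<40 →
      ℕₚ.n≮n (m ^ 40) (ℕₚ.≤-trans d₀≤d (ℕₚ.≤-trans d≤m^D (ℕₚ.^-monoʳ-≤ m {{m≢0}} {D} {40} (ℕₚ.<⇒≤ D<40))))
      where
        d≤m^D : d ≤ m ^ D
        d≤m^D = ℕₚ.*-cancelˡ-≤ (D ^ D) {{ℕ.>-nonZero (1≤^ {D} D (s≤s z≤n))}} (begin
          D ^ D * d          ≤⟨ upper ⟩
          (m * t) ^ D        ≤⟨ ℕₚ.^-monoˡ-≤ D (ℕₚ.*-monoʳ-≤ m (t≤D 3t′<D)) ⟩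
          (m * D) ^ D        ≡⟨ ^-distribʳ-* m D D ⟩
          m ^ D * D ^ D      ≡⟨ ℕₚ.*-comm (m ^ D) (D ^ D) ⟩
          D ^ D * m ^ D      ∎)

    [ma]^D<4^Dd : ∀ a → D * a ≤ 4 * t′ → (m * t′) ^ D < D ^ D * d → (m * a) ^ D < 4 ^ D * d
    [ma]^D<4^Dd a Da≤4t′ lower = ℕₚ.*-cancelˡ-< (D ^ D) _ _ (begin-strict
      D ^ D * (m * a) ^ D       ≡⟨ ^-distribʳ-* D (m * a) D ⟨
      (D * (m * a)) ^ D         ≡⟨ ≡.cong (_^ D) (x*[y*z]≡y*[x*z] D m a) ⟩
      (m * (D * a)) ^ D         ≤⟨ ℕₚ.^-monoˡ-≤ D (ℕₚ.*-monoʳ-≤ m Da≤4t′) ⟩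
      (m * (4 * t′)) ^ D        ≡⟨ ≡.cong (_^ D) (x*[y*z]≡y*[x*z] m 4 t′) ⟩
      (4 * (m * t′)) ^ D        ≡⟨ ^-distribʳ-* 4 (m * t′) D ⟩
      4 ^ D * (m * t′) ^ D      <⟨ ℕₚ.*-monoʳ-< (4 ^ D) {{ℕ.>-nonZero (1≤^ {4} D (s≤s z≤n))}} lower ⟩
      4 ^ D * (D ^ D * d)       ≡⟨ x*[y*z]≡y*[x*z] (4 ^ D) (D ^ D) d ⟩
      D ^ D * (4 ^ D * d)       ∎)

    module _ (ks : List ℕ) (1≤ks : All (1 ≤_) ks) (sum< : sum (map pred ks) < t) where

      product≤a^L*2^L : ∀ a → 1 ≤ a → t ≤ D * a → length ks ≤ L → product ks ≤ a ^ L * 2 ^ L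
      product≤a^L*2^L a 1≤a t≤Da ∣ks∣≤L =
        let Q , aQ≤ , ks≤a^∣ks∣2^Q = product≤a^length*2^Q a 1≤a ks 1≤ks
            Q<D = ℕₚ.*-cancelˡ-< a Q D (begin-strict
              a * Q              ≤⟨ aQ≤ ⟩
              sum (map pred ks)  <⟨ sum< ⟩
              t                  ≤⟨ t≤Da ⟩
              D * a              ≡⟨ ℕₚ.*-comm D a ⟩
              a * D              ∎)
        in ℕₚ.≤-trans ks≤a^∣ks∣2^Q (ℕₚ.*-mono-≤ (ℕₚ.^-monoʳ-≤ a {{ℕ.>-nonZero 1≤a}} ∣ks∣≤L) (ℕₚ.^-monoʳ-≤ 2 (ℕₚ.≤-pred Q<D)))

      product-bound-large : ∀ q → t ≤ D * suc q → D * suc q ≤ 4 * t′ → (m * t′) ^ D < D ^ D * d →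
                            length ks ≤ L → product ks * ((801 + D) * t) ≤ 4 * d
      product-bound-large q t≤Da Da≤4t′ lower ∣ks∣≤L =
        ℕₚ.*-cancelˡ-≤ (m ^ D) {{ℕ.>-nonZero (1≤^ {m} D 1≤m)}} (begin
          m ^ D * (product ks * ((801 + D) * t))
            ≤⟨ ℕₚ.*-monoʳ-≤ (m ^ D) (ℕₚ.*-mono-≤ (product≤a^L*2^L a (s≤s z≤n) t≤Da ∣ks∣≤L) (ℕₚ.*-monoʳ-≤ (801 + D) t≤Da)) ⟩
          m ^ D * ((a ^ L * 2 ^ L) * ((801 + D) * (D * a)))
            ≡⟨ rearrange (m ^ D) (a ^ L) (2 ^ L) (801 + D) D a ⟩
          K * (m ^ D * (a * a ^ L))  ≡⟨ ≡.cong (K *_) (^-distribʳ-* m a D) ⟨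
          K * (m * a) ^ D            ≤⟨ ℕₚ.*-monoʳ-≤ K (ℕₚ.<⇒≤ ([ma]^D<4^Dd a Da≤4t′ lower)) ⟩
          K * (4 ^ D * d)            ≡⟨ ℕₚ.*-assoc K (4 ^ D) d ⟨
          K * 4 ^ D * d              ≤⟨ ℕₚ.*-monoˡ-≤ d (2^L*[801+D]D*4^D≤4m^D L) ⟩
          4 * m ^ D * d              ≡⟨ ≡.trans (ℕₚ.*-assoc 4 (m ^ D) d) (x*[y*z]≡y*[x*z] 4 (m ^ D) d) ⟩
          m ^ D * (4 * d)            ∎)
        where
          a = suc q
          K = 2 ^ L * ((801 + D) * D)
          rearrange : ∀ M A P C D a → M * ((A * P) * (C * (D * a))) ≡ (P * (C * D)) * (M * (a * A))
          rearrange = solve 6 (λ M A P C D a →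
            M :* ((A :* P) :* (C :* (D :* a))) := (P :* (C :* D)) :* (M :* (a :* A))) refl

      product-bound-small : 3 * t′ < D → 40 ≤ D → 2 ^ D ≤ d → product ks * ((801 + D) * t) ≤ 4 * d
      product-bound-small 3t′<D 40≤D 2^D≤d = begin
        product ks * ((801 + D) * t)        ≤⟨ ℕₚ.*-mono-≤ ks≤ (ℕₚ.*-mono-≤ (ℕₚ.+-monoʳ-≤ 801 D≤2u)
                                                                           (ℕₚ.≤-trans (t≤D 3t′<D) D≤2u)) ⟩
        2 ^ t′ * ((801 + 2 * u) * (2 * u))  ≤⟨ ℕₚ.*-monoʳ-≤ (2 ^ t′) ([801+2u]2u≤4*2^u u 20≤u) ⟩
        2 ^ t′ * (4 * 2 ^ u)                ≡⟨ x*[y*z]≡y*[x*z] (2 ^ t′) 4 (2 ^ u) ⟩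
        4 * (2 ^ t′ * 2 ^ u)                ≡⟨ ≡.cong (4 *_) (ℕₚ.^-distribˡ-+-* 2 t′ u) ⟨
        4 * 2 ^ (t′ + u)                    ≡⟨ ≡.cong (λ x → 4 * 2 ^ x) t′+u≡D ⟩
        4 * 2 ^ D                           ≤⟨ ℕₚ.*-monoʳ-≤ 4 2^D≤d ⟩
        4 * d                               ∎
        where
          u = D ∸ t′

          t′+t′≤D : t′ + t′ ≤ D
          t′+t′≤D = ℕₚ.≤-trans (ℕₚ.+-monoʳ-≤ t′ (ℕₚ.m≤m+n t′ (t′ + 0))) (ℕₚ.<⇒≤ 3t′<D)

          t′+u≡D : t′ + u ≡ D
          t′+u≡D = ℕₚ.m+[n∸m]≡n (ℕₚ.≤-trans (ℕₚ.m≤m+n t′ t′) t′+t′≤D)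

          D≤2u : D ≤ 2 * u
          D≤2u = begin
            D            ≡⟨ t′+u≡D ⟨
            t′ + u       ≤⟨ ℕₚ.+-monoˡ-≤ u (ℕₚ.+-cancelˡ-≤ t′ t′ u (ℕₚ.≤-trans t′+t′≤D (ℕₚ.≤-reflexive (≡.sym t′+u≡D)))) ⟩
            u + u        ≡⟨ ≡.cong (u +_) (ℕₚ.+-identityʳ u) ⟨
            2 * u        ∎

          20≤u : 20 ≤ u
          20≤u = ℕₚ.*-cancelˡ-≤ 2 (ℕₚ.≤-trans 40≤D D≤2u)

          ks≤ : product ks ≤ 2 ^ t′
          ks≤ = ℕₚ.≤-trans (product≤2^sum ks 1≤ks) (ℕₚ.^-monoʳ-≤ 2 (ℕₚ.≤-pred sum<))

  feasible : ∀ {d L t′} → let D = suc L in 2 ^ D ≤ d → d₀ ≤ d →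
             (m * t′) ^ D < D ^ D * d → D ^ D * d ≤ (m * suc t′) ^ D → Feasible (4 * d) (suc t′) L
  feasible {d} {L} {t′} 2^D≤d d₀≤d lower upper ks ∣ks∣≤L 1≤ks sum< = begin
    product ks * ((801 + L) * t) + t               ≤⟨ ℕₚ.+-monoʳ-≤ (product ks * ((801 + L) * t)) t≤ ⟩
    product ks * ((801 + L) * t) + product ks * t  ≡⟨ distrib (product ks) L t ⟩
    product ks * ((801 + D) * t)                   ≤⟨ [ large , small ]′ (ℕₚ.≤-<-connex D (3 * t′)) ⟩
    4 * d                                          ∎
    where
      D = suc L
      t = suc t′

      t≤ : t ≤ product ks * t
      t≤ = ℕₚ.≤-trans (ℕₚ.≤-reflexive (≡.sym (ℕₚ.*-identityˡ t))) (ℕₚ.*-monoˡ-≤ t (product≥1 ks 1≤ks))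

      distrib : ∀ P L t → P * ((801 + L) * t) + P * t ≡ P * ((801 + suc L) * t)
      distrib = solve 3 (λ P L t → P :* ((con 801 :+ L) :* t) :+ P :* t := P :* ((con 801 :+ (con 1 :+ L)) :* t)) refl

      large : D ≤ 3 * t′ → product ks * ((801 + D) * t) ≤ 4 * d
      large D≤3t′ =
        let q , Dq≤t′ , t′<D[1+q] = quotient t′ D (s≤s z≤n)
        in product-bound-large {d} {L} {t′} ks 1≤ks sum< q t′<D[1+q] (D[1+q]≤4t D≤3t′ Dq≤t′) lower ∣ks∣≤L

      small : 3 * t′ < D → product ks * ((801 + D) * t) ≤ 4 * d
      small 3t′<D = product-bound-small {d} {L} {t′} ks 1≤ks sum< 3t′<D (40≤D {d} {L} {t′} 3t′<D d₀≤d upper) 2^D≤d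

  choose-t : ∀ d L → let D = suc L in 2 ^ D ≤ d → d₀ ≤ d →
             Σ ℕ λ t → 1 ≤ t × D ^ D * d ≤ (m * t) ^ D × Feasible (4 * d) t L
  choose-t d L 2^D≤d d₀≤d =
    let t′ , too-small , large-enough = crossing Enough (λ x → D ^ D * d ℕ.≤? (m * x) ^ D) zero-too-small (D * d) D*d-enough
    in suc t′ , s≤s z≤n , large-enough , feasible {d} {L} {t′} 2^D≤d d₀≤d (ℕₚ.≰⇒> too-small) large-enough
    where
      D = suc L

      Enough : ℕ → Set
      Enough x = D ^ D * d ≤ (m * x) ^ D

      1≤D^D*d : 1 ≤ D ^ D * d
      1≤D^D*d = ℕₚ.*-mono-≤ {1} {D ^ D} {1} {d} (1≤^ {D} D (s≤s z≤n)) (ℕₚ.≤-trans (1≤^ {2} D (s≤s z≤n)) 2^D≤d)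

      zero-too-small : ¬ Enough 0
      zero-too-small enough = ℕₚ.<⇒≱ 1≤D^D*d (ℕₚ.≤-trans enough (ℕₚ.≤-reflexive (≡.cong (_^ D) (ℕₚ.*-zeroʳ m))))

      D*d-enough : Enough (D * d)
      D*d-enough = begin
        D ^ D * d                ≤⟨ ℕₚ.*-monoʳ-≤ (D ^ D) (ℕₚ.≤-trans (ℕₚ.m≤n*m d m {{m≢0}}) (n≤n^[1+k] (m * d) L 1≤m*d)) ⟩
        D ^ D * (m * d) ^ D      ≡⟨ ^-distribʳ-* D (m * d) D ⟨
        (D * (m * d)) ^ D        ≡⟨ ≡.cong (_^ D) (x*[y*z]≡y*[x*z] D m d) ⟩
        (m * (D * d)) ^ D        ∎
        where
          1≤m*d : 1 ≤ m * d
          1≤m*d = ℕₚ.≤-trans (1≤^ {2} D (s≤s z≤n)) (ℕₚ.≤-trans 2^D≤d (ℕₚ.m≤n*m d m {{m≢0}}))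

open import Data.Nat using (_+_; _*_; _^_)

m : ℕ
m = 2 ^ 16

open Parameters m ℕₚ.≤-refl using (d₀; choose-t)

lemma4p1 : Σ ℕ λ m → 1 ≤ m × Σ ℕ λ d₀ →
    ∀ d → d₀ ≤ d → ∀ Δ → 1 ≤ Δ → 2 ^ Δ ≤ d →
    (F : Field) → let open Poly F in
    ∀ s (Φ : SPF (4 * d) Δ) → SynML Φ → size Φ ≤ s →
    (f : MPoly (4 * d)) → f ≐ eval Φ →
    Σ ℕ λ t → Δ ^ Δ * d ≤ (m * t) ^ Δ ×
    Σ (List (MPoly (4 * d))) λ P → Σ (List (MPoly (4 * d))) λ Q →
    length P ≤ s × length Q ≤ s ×
    All (IsProduct t) P × All (IsSimple t) Q ×
    (f ≐ (sumL P ⊕ sumL Q))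
lemma4p1 = m , NatLemmas.1≤^ {2} 16 (s≤s z≤n) , d₀ , λ where
  d _     zero    ()
  d d₀≤d (suc L) _ 2^Δ≤d F s Φ synML size≤s f f≐Φ →
    case choose-t d L 2^Δ≤d d₀≤d of λ where
      (t , 1≤t , t-large , t-feasible) →
        case Descent.decompose F (4 * d) t L 1≤t t-feasible Φ synML of λ where
          (Decompositions.decomposition P Q P-ok Q-ok count Φ≐) →
            t , t-large , P , Q ,
            ℕₚ.≤-trans (ℕₚ.m≤m+n (length P) (length Q)) (ℕₚ.≤-trans count size≤s) ,
            ℕₚ.≤-trans (ℕₚ.m≤n+m (length Q) (length P)) (ℕₚ.≤-trans count size≤s) ,
            P-ok , Q-ok , PolynomialSemiring.≐-trans F f≐Φ Φ≐
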